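{- For every odd integer $n\geq 3$ and every divisor $k\geq 3$ of $n$, there exists a globally simple $\mathrm{H}_n(n;k)$, i.e. a globally simple Heffter array over $\mathbb{Z}_{n(2k+1)}$ relative to its subgroup of order $n$.
   Context: Let $w=2nk+t$ and let $J$ be the subgroup of $\mathbb{Z}_w$ of order $t$. A half-set of $\mathbb{Z}_w\setminus J$ is a subset $V$ of size $nk$ with $V\cup(-V)=\mathbb{Z}_w\setminus J$. An $\mathrm{H}_t(n;k)$ Heffter array over $\mathbb{Z}_w$ relative to $J$ is an $n\times n$ partially filled array with entries in $\mathbb{Z}_w$ such that each row and each column has exactly $k$ filled cells, the entries form a half-set of $\mathbb{Z}_w\setminus J$, and every row and every column sums to $0$ in $\mathbb{Z}_w$. A sequence $(b_0,\dots,b_{k-1})$ of group elements is a simple ordering if its partial sums $c_i=\sum_{j=0}^{i}b_j$, $0\le i\le k-1$, are pairwise distinct. The array is globally simple if, for every row, the entries read from left to right form a simple ordering, and for every column, the entries read from top to bottom form a simple ordering. -}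

module Defs where

open import Data.Nat using (ℕ; zero; suc; _+_; _*_; _≥_)
open import Data.Nat.Divisibility using (_∣_)
open import Data.Integer as ℤ using (ℤ; +_)
import Data.Integer.Divisibility as ℤD
open import Data.Fin using (Fin; toℕ)
open import Data.Maybe using (Maybe; just; nothing)
open import Data.List using (List; []; _∷_; mapMaybe; allFin; length; map; concatMap)
open import Data.Nat.ListAction using (sum)
open import Data.List.Membership.Propositional using (_∈_)
open import Data.List.Relation.Unary.AllPairs using (AllPairs)
open import Data.List.Relation.Unary.Any using (Any)
open import Data.Product using (Σ; _×_; ∃)
open import Data.Sum using (_⊎_)
open import Relation.Nullary using (¬_)
open import Relation.Binary.PropositionalEquality using (_≡_)
open import Function.Bundles using (_⇔_)

-- Elements of ℤ_w are represented by Fin w (the residues 0,…,w-1);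
-- group operations are computed on representatives, and equality in ℤ_w
-- of natural numbers a, b is congruence modulo w.
_≡_[mod_] : ℕ → ℕ → ℕ → Set
a ≡ b [mod w ] = (+ w) ℤD.∣ ((+ a) ℤ.- (+ b))

Array : ℕ → ℕ → Set
Array n w = Fin n → Fin n → Maybe (Fin w)

rowEntries : ∀ {n w} → Array n w → Fin n → List (Fin w)
rowEntries {n} A i = mapMaybe (λ j → A i j) (allFin n)

colEntries : ∀ {n w} → Array n w → Fin n → List (Fin w)
colEntries {n} A j = mapMaybe (λ i → A i j) (allFin n)

allEntries : ∀ {n w} → Array n w → List (Fin w)
allEntries {n} A = concatMap (rowEntries A) (allFin n)

partialSums : ℕ → List ℕ → List ℕ
partialSums acc []       = []
partialSums acc (x ∷ xs) = (acc + x) ∷ partialSums (acc + x) xs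

SimpleOrdering : (w : ℕ) → List (Fin w) → Set
SimpleOrdering w bs = AllPairs (λ a b → ¬ (a ≡ b [mod w ])) (partialSums 0 (map toℕ bs))

SumsToZero : (w : ℕ) → List (Fin w) → Set
SumsToZero w bs = w ∣ sum (map toℕ bs)

-- Heffter array H_t(n;k) over ℤ_w (w = 2nk+t) relative to the subgroup J,
-- where J is given as a predicate on ℤ_w.
record IsHeffter (n k t : ℕ) (J : Fin (2 * n * k + t) → Set)
                 (A : Array n (2 * n * k + t)) : Set where
  field
    rowsFilled : ∀ i → length (rowEntries A i) ≡ k
    colsFilled : ∀ j → length (colEntries A j) ≡ k
    -- the entries form a half-set V of ℤ_w ∖ J:
    -- distinct cells hold distinct elements (so |V| = nk by the counts above)
    entriesDistinct : ∀ i j i' j' x → A i j ≡ just x → A i' j' ≡ just x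
                      → (i ≡ i') × (j ≡ j')
    halfSet : ∀ (x : Fin (2 * n * k + t)) →
              (¬ J x) ⇔ (x ∈ allEntries A ⊎
                         Any (λ y → (toℕ y + toℕ x) ≡ 0 [mod (2 * n * k + t) ]) (allEntries A))
    rowSums : ∀ i → SumsToZero (2 * n * k + t) (rowEntries A i)
    colSums : ∀ j → SumsToZero (2 * n * k + t) (colEntries A j)

GloballySimple : ∀ {n w} → Array n w → Set
GloballySimple {n} {w} A =
  (∀ i → SimpleOrdering w (rowEntries A i)) × (∀ j → SimpleOrdering w (colEntries A j))

-- the subgroup of ℤ_{n(2k+1)} of order n: the multiples of 2k+1
-- (note 2nk + n = n(2k+1))
J-order-n : (n k : ℕ) → Fin (2 * n * k + n) → Set
J-order-n n k x = (2 * k + 1) ∣ toℕ x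

module Submission where

-- The array is a cyclic band: cell (i, j) is filled when d = (i + j) mod n is below k, and then holds
-- Δ d + (2k + 1) · u d · i modulo n (2k + 1). Here Δ d = P (d + 1) - P d are the steps of a closed walk
-- P 0, …, P k = P 0 through k distinct residues modulo 2k + 1 whose steps are ±1, …, ±k, each once
-- (a zigzag, built separately for t odd and t even where k = 2t + 1), and u d ∈ {1, ±2} are units
-- modulo the odd n with Σ u d = Σ d · u d = 0.
-- Modulo 2k + 1 an entry only depends on d, and since u d is invertible the n entries on the diagonal d
-- are all the lifts of Δ d; so the entries form a half-set of the non-multiples of 2k + 1.
-- Read along a row or a column, the entries are the successive differences of a potential that closes
-- up after k steps and agrees with P modulo 2k + 1: hence every line sums to 0, and its partial sums
-- are the shifted values of P, which are pairwise distinct.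

open import Defs
open import Data.Nat using (ℕ; _≥_; _*_; _+_)
open import Data.Nat.Divisibility using (_∣_)
open import Data.Product using (Σ; _×_)
open import Relation.Nullary using (¬_)

open import Data.Empty using (⊥-elim)
open import Data.Fin as Fin using (Fin; toℕ)
import Data.Fin.Properties as Finₚ
open import Data.Integer as ℤ using (ℤ; +_; 0ℤ; 1ℤ)
  renaming (_+_ to _+ᶻ_; _-_ to _-ᶻ_; _*_ to _*ᶻ_; -_ to -ᶻ_)
import Data.Integer.DivMod as ℤ%
open import Data.Integer.Divisibility.Signed as ℤ∣ using (divides) renaming (_∣_ to _∣ᶻ_)
import Data.Integer.Properties as ℤₚ
open import Data.Integer.Tactic.RingSolver using (solve-∀)
open import Data.List using (List; []; _∷_; _++_; map; applyUpTo; tabulate; catMaybes; mapMaybe; length; allFin)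
open import Data.List.Membership.Propositional using (_∈_)
open import Data.List.Properties using (map-applyUpTo; length-map; length-applyUpTo; map-tabulate)
open import Data.List.Relation.Unary.AllPairs using (AllPairs)
import Data.List.Relation.Unary.AllPairs.Properties as AllPairs
open import Data.List.Relation.Unary.Any using (Any; here; there)
import Data.List.Relation.Unary.Any.Properties as Anyₚ
open import Data.Maybe using (Maybe; just; nothing)
open import Data.Maybe.Properties using (just-injective)
open import Data.Maybe.Relation.Unary.Any using (just) renaming (Any to MaybeAny)
open import Data.Nat as ℕ using (zero; suc; _∸_; _≤_; _<_; z≤n; s≤s; s≤s⁻¹; NonZero; _%_; _/_; _<?_; _≤?_)
open import Data.Nat.DivMod
  using (m<n⇒m%n≡m; m%n<n; m≡m%n+[m/n]*n; m*n%n≡0; [m+kn]%n≡m%n; [m+n]%n≡m%n; n%n≡0)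
import Data.Nat.Divisibility as ℕ∣
open import Data.Nat.ListAction using (sum)
import Data.Nat.Properties as ℕₚ
import Data.Nat.Tactic.RingSolver as ℕ-Solver
open import Data.Product using (_,_; proj₁; proj₂; ∃; map₂)
open import Data.Sum as Sum using (_⊎_; inj₁; inj₂)
open import Function using (_∘_)
open import Function.Bundles using (_⇔_; mk⇔)
open import Relation.Binary.Bundles using (Setoid)
open import Relation.Binary.Definitions using (tri<; tri≈; tri>)
open import Relation.Binary.PropositionalEquality
import Relation.Binary.Reasoning.Setoid as SetoidReasoning
open import Relation.Nullary using (Dec; yes; no; contradiction)

-- Congruences of integers

infix 4 _≡_[modᶻ_]
record _≡_[modᶻ_] (a b m : ℤ) : Set where
  constructor modᶻ
  field m∣a-b : m ∣ᶻ a -ᶻ b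

module _ {m : ℤ} where

  modᶻ-refl : ∀ {a} → a ≡ a [modᶻ m ]
  modᶻ-refl {a} = modᶻ (divides 0ℤ (trans (ℤₚ.+-inverseʳ a) (sym (ℤₚ.*-zeroˡ m))))

  modᶻ-reflexive : ∀ {a b} → a ≡ b → a ≡ b [modᶻ m ]
  modᶻ-reflexive refl = modᶻ-refl

  modᶻ-sym : ∀ {a b} → a ≡ b [modᶻ m ] → b ≡ a [modᶻ m ]
  modᶻ-sym {a} {b} (modᶻ p) = modᶻ (subst (m ∣ᶻ_) (swap a b) (ℤ∣.∣m⇒∣-m p))
    where
    swap : ∀ a b → -ᶻ (a -ᶻ b) ≡ b -ᶻ a
    swap = solve-∀

  modᶻ-trans : ∀ {a b c} → a ≡ b [modᶻ m ] → b ≡ c [modᶻ m ] → a ≡ c [modᶻ m ]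
  modᶻ-trans {a} {b} {c} (modᶻ p) (modᶻ q) = modᶻ (subst (m ∣ᶻ_) (chain a b c) (ℤ∣.∣m∣n⇒∣m+n p q))
    where
    chain : ∀ a b c → (a -ᶻ b) +ᶻ (b -ᶻ c) ≡ a -ᶻ c
    chain = solve-∀

  modᶻ-+ : ∀ {a b c d} → a ≡ b [modᶻ m ] → c ≡ d [modᶻ m ] → a +ᶻ c ≡ b +ᶻ d [modᶻ m ]
  modᶻ-+ {a} {b} {c} {d} (modᶻ p) (modᶻ q) = modᶻ (subst (m ∣ᶻ_) (regroup a b c d) (ℤ∣.∣m∣n⇒∣m+n p q))
    where
    regroup : ∀ a b c d → (a -ᶻ b) +ᶻ (c -ᶻ d) ≡ (a +ᶻ c) -ᶻ (b +ᶻ d)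
    regroup = solve-∀

  modᶻ-neg : ∀ {a b} → a ≡ b [modᶻ m ] → -ᶻ a ≡ -ᶻ b [modᶻ m ]
  modᶻ-neg {a} {b} (modᶻ p) = modᶻ (subst (m ∣ᶻ_) (regroup a b) (ℤ∣.∣m⇒∣-m p))
    where
    regroup : ∀ a b → -ᶻ (a -ᶻ b) ≡ -ᶻ a -ᶻ -ᶻ b
    regroup = solve-∀

  modᶻ-*ˡ : ∀ c {a b} → a ≡ b [modᶻ m ] → c *ᶻ a ≡ c *ᶻ b [modᶻ m ]
  modᶻ-*ˡ c {a} {b} (modᶻ p) = modᶻ (subst (m ∣ᶻ_) (distrib c a b) (ℤ∣.∣n⇒∣m*n c p))
    where
    distrib : ∀ c a b → c *ᶻ (a -ᶻ b) ≡ c *ᶻ a -ᶻ c *ᶻ b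
    distrib = solve-∀

  modᶻ-+-cancelˡ : ∀ x {a b} → x +ᶻ a ≡ x +ᶻ b [modᶻ m ] → a ≡ b [modᶻ m ]
  modᶻ-+-cancelˡ x {a} {b} (modᶻ p) = modᶻ (subst (m ∣ᶻ_) (cancel x a b) p)
    where
    cancel : ∀ x a b → (x +ᶻ a) -ᶻ (x +ᶻ b) ≡ a -ᶻ b
    cancel = solve-∀

  modᶻ-+-cancelʳ : ∀ x {a b} → a +ᶻ x ≡ b +ᶻ x [modᶻ m ] → a ≡ b [modᶻ m ]
  modᶻ-+-cancelʳ x {a} {b} (modᶻ p) = modᶻ (subst (m ∣ᶻ_) (cancel x a b) p)
    where
    cancel : ∀ x a b → (a +ᶻ x) -ᶻ (b +ᶻ x) ≡ a -ᶻ b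
    cancel = solve-∀

  +-multiple-modᶻ : ∀ a q → a +ᶻ q *ᶻ m ≡ a [modᶻ m ]
  +-multiple-modᶻ a q = modᶻ (divides q (cancel a q m))
    where
    cancel : ∀ a q m → (a +ᶻ q *ᶻ m) -ᶻ a ≡ q *ᶻ m
    cancel = solve-∀

modᶻ-setoid : ℤ → Setoid _ _
modᶻ-setoid m = record
  { Carrier       = ℤ
  ; _≈_           = _≡_[modᶻ m ]
  ; isEquivalence = record { refl = modᶻ-refl ; sym = modᶻ-sym ; trans = modᶻ-trans }
  }

module ≡-modᶻ-Reasoning (m : ℤ) = SetoidReasoning (modᶻ-setoid m)

modᶻ-*ʳ : ∀ {m a b} c → a ≡ b [modᶻ m ] → a *ᶻ c ≡ b *ᶻ c [modᶻ m ]
modᶻ-*ʳ {m} {a} {b} c p = subst₂ (λ x y → x ≡ y [modᶻ m ]) (ℤₚ.*-comm c a) (ℤₚ.*-comm c b) (modᶻ-*ˡ c p)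

modᶻ-*ʳ-modulus : ∀ c {m a b} → a ≡ b [modᶻ m ] → a *ᶻ c ≡ b *ᶻ c [modᶻ m *ᶻ c ]
modᶻ-*ʳ-modulus c {m} {a} {b} (modᶻ p) = modᶻ (subst (m *ᶻ c ∣ᶻ_) (distrib c a b) (ℤ∣.*-monoˡ-∣ c p))
  where
  distrib : ∀ c a b → (a -ᶻ b) *ᶻ c ≡ a *ᶻ c -ᶻ b *ᶻ c
  distrib = solve-∀

modᶻ-*ʳ-modulus⁻¹ : ∀ c {m a b} .{{_ : ℤ.NonZero c}} →
                    a *ᶻ c ≡ b *ᶻ c [modᶻ m *ᶻ c ] → a ≡ b [modᶻ m ]
modᶻ-*ʳ-modulus⁻¹ c {m} {a} {b} (modᶻ p) =
  modᶻ (ℤ∣.*-cancelʳ-∣ c (subst (m *ᶻ c ∣ᶻ_) (sym (distrib c a b)) p))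
  where
  distrib : ∀ c a b → (a -ᶻ b) *ᶻ c ≡ a *ᶻ c -ᶻ b *ᶻ c
  distrib = solve-∀

modᶻ-divisor : ∀ {d m a b} → d ∣ᶻ m → a ≡ b [modᶻ m ] → a ≡ b [modᶻ d ]
modᶻ-divisor d∣m (modᶻ p) = modᶻ (ℤ∣.∣-trans d∣m p)

[mod]⇒modᶻ : ∀ {w a b} → a ≡ b [mod w ] → + a ≡ + b [modᶻ + w ]
[mod]⇒modᶻ p = modᶻ (ℤ∣.∣ᵤ⇒∣ p)

modᶻ⇒[mod] : ∀ {w a b} → + a ≡ + b [modᶻ + w ] → a ≡ b [mod w ]
modᶻ⇒[mod] (modᶻ p) = ℤ∣.∣⇒∣ᵤ p

∣⇒modᶻ0 : ∀ {w x} → w ∣ x → + x ≡ 0ℤ [modᶻ + w ]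
∣⇒modᶻ0 {w} {x} p = modᶻ (subst (+ w ∣ᶻ_) (sym (ℤₚ.+-identityʳ (+ x))) (ℤ∣.∣ᵤ⇒∣ p))

modᶻ0⇒∣ : ∀ {w x} → + x ≡ 0ℤ [modᶻ + w ] → w ∣ x
modᶻ0⇒∣ {w} {x} (modᶻ p) = ℤ∣.∣⇒∣ᵤ (subst (+ w ∣ᶻ_) (ℤₚ.+-identityʳ (+ x)) p)

%ℕ-modᶻ : ∀ x m .{{_ : NonZero m}} → + (x ℤ.%ℕ m) ≡ x [modᶻ + m ]
%ℕ-modᶻ x m = modᶻ-sym (subst (_≡ + (x ℤ.%ℕ m) [modᶻ + m ]) (sym (ℤ%.a≡a%ℕn+[a/ℕn]*n x m))
                                (+-multiple-modᶻ (+ (x ℤ.%ℕ m)) (x ℤ./ℕ m)))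

%-modᶻ : ∀ x m .{{_ : NonZero m}} → + (x % m) ≡ + x [modᶻ + m ]
%-modᶻ x = %ℕ-modᶻ (+ x)

∣<⇒≡0 : ∀ {m x} → m ∣ x → x < m → x ≡ 0
∣<⇒≡0 {m} {x} m∣x x<m = trans (sym (m<n⇒m%n≡m x<m)) (ℕ∣.n∣m⇒m%n≡0 x m m∣x)
  where instance _ = ℕ.>-nonZero (ℕₚ.≤-<-trans z≤n x<m)

pos-∸ : ∀ {m n} → n ≤ m → + (m ∸ n) ≡ + m -ᶻ + n
pos-∸ {m} {n} n≤m = trans (sym (ℤₚ.⊖-≥ n≤m)) (sym (ℤₚ.m-n≡m⊖n m n))

private
  ≤-modᶻ⇒≡ : ∀ {m a b} → a ≤ b → b < m → + b ≡ + a [modᶻ + m ] → b ≡ a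
  ≤-modᶻ⇒≡ {m} {a} {b} a≤b b<m (modᶻ p) = ℕₚ.≤-antisym (ℕₚ.m∸n≡0⇒m≤n b∸a≡0) a≤b
    where
    b∸a≡0 : b ∸ a ≡ 0
    b∸a≡0 = ∣<⇒≡0 (ℤ∣.∣⇒∣ᵤ (subst (+ m ∣ᶻ_) (trans (ℤₚ.m-n≡m⊖n b a) (ℤₚ.⊖-≥ a≤b)) p))
                  (ℕₚ.≤-<-trans (ℕₚ.m∸n≤m b a) b<m)

modᶻ⇒≡ : ∀ {m a b} → a < m → b < m → + a ≡ + b [modᶻ + m ] → a ≡ b
modᶻ⇒≡ {m} {a} {b} a<m b<m p with ℕₚ.≤-total a b
... | inj₁ a≤b = sym (≤-modᶻ⇒≡ a≤b b<m (modᶻ-sym p))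
... | inj₂ b≤a = ≤-modᶻ⇒≡ b≤a a<m p

module _ {A : Set} where

  applyUpTo-cong : ∀ {f g : ℕ → A} L → (∀ {x} → x < L → f x ≡ g x) → applyUpTo f L ≡ applyUpTo g L
  applyUpTo-cong zero    eq = refl
  applyUpTo-cong (suc L) eq = cong₂ _∷_ (eq (s≤s z≤n)) (applyUpTo-cong L (eq ∘ s≤s))

  applyUpTo-++ : ∀ (f : ℕ → A) a b → applyUpTo f (a + b) ≡ applyUpTo f a ++ applyUpTo (λ x → f (a + x)) b
  applyUpTo-++ f zero    b = refl
  applyUpTo-++ f (suc a) b = cong (f 0 ∷_) (applyUpTo-++ (f ∘ suc) a b)

  tabulate-toℕ : ∀ {B : Set} n (g : ℕ → B) → tabulate {n = n} (g ∘ toℕ) ≡ applyUpTo g n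
  tabulate-toℕ zero    g = refl
  tabulate-toℕ (suc n) g = cong (g 0 ∷_) (tabulate-toℕ n (g ∘ suc))

  mapMaybe-allFin : ∀ n (g : ℕ → Maybe A) → mapMaybe (g ∘ toℕ) (allFin n) ≡ catMaybes (applyUpTo g n)
  mapMaybe-allFin n g = cong catMaybes (trans (map-tabulate (λ i → i) (g ∘ toℕ)) (tabulate-toℕ n g))

  applyUpTo-rotate : ∀ (f : ℕ → A) {n ρ} .{{_ : NonZero n}} → ρ ≤ n →
    applyUpTo (λ x → f ((ρ + x) % n)) n ≡ applyUpTo (λ x → f (ρ + x)) (n ∸ ρ) ++ applyUpTo f ρ
  applyUpTo-rotate f {n} {ρ} ρ≤n = begin
    applyUpTo g n                                                 ≡⟨ cong (applyUpTo g) (sym (ℕₚ.m∸n+n≡m ρ≤n)) ⟩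
    applyUpTo g ((n ∸ ρ) + ρ)                                     ≡⟨ applyUpTo-++ g (n ∸ ρ) ρ ⟩
    applyUpTo g (n ∸ ρ) ++ applyUpTo (λ y → g ((n ∸ ρ) + y)) ρ    ≡⟨ cong₂ _++_ (applyUpTo-cong (n ∸ ρ) unshifted)
                                                                                  (applyUpTo-cong ρ wrapped) ⟩
    applyUpTo (λ x → f (ρ + x)) (n ∸ ρ) ++ applyUpTo f ρ          ∎
    where
    open ≡-Reasoning
    g : ℕ → A
    g x = f ((ρ + x) % n)
    unshifted : ∀ {x} → x < n ∸ ρ → g x ≡ f (ρ + x)
    unshifted {x} x<n∸ρ = cong f (m<n⇒m%n≡m (subst (ρ + x <_) (ℕₚ.m+[n∸m]≡n ρ≤n) (ℕₚ.+-monoʳ-< ρ x<n∸ρ)))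
    wrapped : ∀ {y} → y < ρ → g ((n ∸ ρ) + y) ≡ f y
    wrapped {y} y<ρ = cong f (begin
      (ρ + ((n ∸ ρ) + y)) % n   ≡⟨ cong (_% n) (trans (sym (ℕₚ.+-assoc ρ (n ∸ ρ) y)) (cong (_+ y) (ℕₚ.m+[n∸m]≡n ρ≤n))) ⟩
      (n + y) % n               ≡⟨ cong (_% n) (ℕₚ.+-comm n y) ⟩
      (y + n) % n               ≡⟨ [m+n]%n≡m%n y n ⟩
      y % n                     ≡⟨ m<n⇒m%n≡m (ℕₚ.<-≤-trans y<ρ ρ≤n) ⟩
      y                         ∎)

  catMaybes-++ : ∀ (xs ys : List (Maybe A)) → catMaybes (xs ++ ys) ≡ catMaybes xs ++ catMaybes ys
  catMaybes-++ []             ys = refl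
  catMaybes-++ (just x ∷ xs)  ys = cong (x ∷_) (catMaybes-++ xs ys)
  catMaybes-++ (nothing ∷ xs) ys = catMaybes-++ xs ys

  catMaybes-applyUpTo : ∀ (h : ℕ → Maybe A) (F : ℕ → A) {m L} → m ≤ L →
    (∀ {x} → x < m → h x ≡ just (F x)) → (∀ {x} → m ≤ x → x < L → h x ≡ nothing) →
    catMaybes (applyUpTo h L) ≡ applyUpTo F m
  catMaybes-applyUpTo h F {zero}  {zero}  _         _   _  = refl
  catMaybes-applyUpTo h F {zero}  {suc L} _         _      empty rewrite empty z≤n (s≤s (z≤n {L})) =
    catMaybes-applyUpTo (h ∘ suc) F z≤n (λ ()) (λ _ x<L → empty z≤n (s≤s x<L))
  catMaybes-applyUpTo h F {suc m} {suc L} (s≤s m≤L) filled empty rewrite filled (s≤s (z≤n {m})) =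
    cong (F 0 ∷_) (catMaybes-applyUpTo (h ∘ suc) (F ∘ suc) m≤L (filled ∘ s≤s)
                                       (λ m≤x x<L → empty (s≤s m≤x) (s≤s x<L)))

rotation : (k : ℕ) .{{_ : NonZero k}} → ℕ → List ℕ
rotation k ρ = applyUpTo (λ x → (ρ + x) % k) k

band-line : ∀ {A : Set} {n k c} .{{_ : NonZero n}} .{{_ : NonZero k}} (g : ℕ → Maybe A) (F : ℕ → A) →
  k ≤ n → c < n → (∀ {d} → d < k → g d ≡ just (F d)) → (∀ {d} → k ≤ d → g d ≡ nothing) →
  ∃ λ ρ → catMaybes (applyUpTo (λ x → g ((c + x) % n)) n) ≡ map F (rotation k ρ)
band-line {n = n} {k} {c} g F k≤n c<n filled empty = ρ , (begin
  catMaybes (applyUpTo (λ x → g ((c + x) % n)) n)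
    ≡⟨ cong catMaybes (applyUpTo-rotate g (ℕₚ.<⇒≤ c<n)) ⟩
  catMaybes (upper ++ lower)
    ≡⟨ catMaybes-++ upper lower ⟩
  catMaybes upper ++ catMaybes lower
    ≡⟨ rotated ⟩
  applyUpTo (λ x → F ((ρ + x) % k)) k
    ≡⟨ map-applyUpTo _ F k ⟨
  map F (rotation k ρ)
    ∎)
  where
  open ≡-Reasoning
  upper lower : List (Maybe _)
  upper = applyUpTo (λ x → g (c + x)) (n ∸ c)
  lower = applyUpTo g c
  ρ : ℕ
  ρ with c <? k
  ... | yes _ = c
  ... | no  _ = 0
  rotated : catMaybes upper ++ catMaybes lower ≡ applyUpTo (λ x → F ((ρ + x) % k)) k
  rotated with c <? k
  ... | yes c<k = trans
    (cong₂ _++_ (catMaybes-applyUpTo (λ x → g (c + x)) (λ x → F (c + x)) (ℕₚ.∸-monoˡ-≤ c k≤n) upper-filled upper-empty)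
                (catMaybes-applyUpTo g F {c} {c} ℕₚ.≤-refl (λ x<c → filled (ℕₚ.<-trans x<c c<k))
                                     (λ c≤x x<c → ⊥-elim (ℕₚ.<-irrefl refl (ℕₚ.<-≤-trans x<c c≤x)))))
    (sym (applyUpTo-rotate F (ℕₚ.<⇒≤ c<k)))
    where
    c≤k = ℕₚ.<⇒≤ c<k
    upper-filled : ∀ {x} → x < k ∸ c → g (c + x) ≡ just (F (c + x))
    upper-filled x<k∸c = filled (subst (_ <_) (ℕₚ.m+[n∸m]≡n c≤k) (ℕₚ.+-monoʳ-< c x<k∸c))
    upper-empty : ∀ {x} → k ∸ c ≤ x → x < n ∸ c → g (c + x) ≡ nothing
    upper-empty k∸c≤x _ = empty (subst (_≤ _) (ℕₚ.m+[n∸m]≡n c≤k) (ℕₚ.+-monoʳ-≤ c k∸c≤x))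
  ... | no c≮k = trans
    (cong₂ _++_ (catMaybes-applyUpTo (λ x → g (c + x)) F {0} {n ∸ c} z≤n (λ ())
                                     (λ _ _ → empty (ℕₚ.≤-trans k≤c (ℕₚ.m≤m+n c _))))
                (catMaybes-applyUpTo g F {k} {c} k≤c filled (λ k≤x _ → empty k≤x)))
    (applyUpTo-cong k (λ x<k → cong F (sym (m<n⇒m%n≡m x<k))))
    where
    k≤c = ℕₚ.≮⇒≥ c≮k

telescope : ∀ {m} (b : ℕ → ℕ) (H : ℕ → ℤ) L → (∀ {x} → x < L → + b x ≡ H (suc x) -ᶻ H x [modᶻ m ]) →
            + sum (applyUpTo b L) ≡ H L -ᶻ H 0 [modᶻ m ]
telescope b H zero    step = modᶻ-reflexive (sym (ℤₚ.+-inverseʳ (H 0)))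
telescope b H (suc L) step = modᶻ-trans (modᶻ-reflexive (ℤₚ.pos-+ (b 0) _))
  (modᶻ-trans (modᶻ-+ (step (s≤s z≤n)) (telescope (b ∘ suc) (H ∘ suc) L (step ∘ s≤s)))
              (modᶻ-reflexive (chain (H 0) (H 1) (H (suc L)))))
  where
  chain : ∀ a b c → (b -ᶻ a) +ᶻ (c -ᶻ b) ≡ c -ᶻ a
  chain = solve-∀

partialSums-applyUpTo : ∀ acc (b : ℕ → ℕ) L →
  partialSums acc (applyUpTo b L) ≡ applyUpTo (λ x → acc + sum (applyUpTo b (suc x))) L
partialSums-applyUpTo acc b zero    = refl
partialSums-applyUpTo acc b (suc L) = cong₂ _∷_ (cong (λ y → acc + y) (sym (ℕₚ.+-identityʳ (b 0))))
  (trans (partialSums-applyUpTo (acc + b 0) (b ∘ suc) L)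
         (applyUpTo-cong L (λ {x} _ → ℕₚ.+-assoc acc (b 0) (sum (applyUpTo (b ∘ suc) (suc x))))))

[1+m]%n≡[1+m%n]%n : ∀ a k .{{_ : NonZero k}} → suc a % k ≡ suc (a % k) % k
[1+m]%n≡[1+m%n]%n a k = begin
  suc a % k                        ≡⟨ cong (λ y → suc y % k) (m≡m%n+[m/n]*n a k) ⟩
  (suc (a % k) + (a / k) * k) % k  ≡⟨ [m+kn]%n≡m%n (suc (a % k)) (a / k) k ⟩
  suc (a % k) % k                  ∎
  where open ≡-Reasoning

suc-%-cases : ∀ a k .{{_ : NonZero k}} → suc (a % k) ≡ suc a % k ⊎ (suc (a % k) ≡ k × suc a % k ≡ 0)
suc-%-cases a k with suc (a % k) <? k
... | yes a%k+1<k = inj₁ (sym (trans ([1+m]%n≡[1+m%n]%n a k) (m<n⇒m%n≡m a%k+1<k)))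
... | no  a%k+1≮k = inj₂ (a%k+1≡k , trans ([1+m]%n≡[1+m%n]%n a k) (trans (cong (_% k) a%k+1≡k) (n%n≡0 k)))
  where a%k+1≡k = ℕₚ.≤-antisym (m%n<n a k) (ℕₚ.≮⇒≥ a%k+1≮k)

pos-+-cancelˡ-modᶻ : ∀ {m} a {x y} → + (a + x) ≡ + (a + y) [modᶻ m ] → + x ≡ + y [modᶻ m ]
pos-+-cancelˡ-modᶻ {m} a {x} {y} p =
  modᶻ-+-cancelˡ (+ a) (subst₂ (λ u v → u ≡ v [modᶻ m ]) (ℤₚ.pos-+ a x) (ℤₚ.pos-+ a y) p)

%-injective : ∀ {k} .{{_ : NonZero k}} a {x y} → x < k → y < k → (a + x) % k ≡ (a + y) % k → x ≡ y
%-injective {k} a {x} {y} x<k y<k eq = modᶻ⇒≡ x<k y<k (pos-+-cancelˡ-modᶻ a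
  (modᶻ-trans (modᶻ-sym (%-modᶻ (a + x) k)) (modᶻ-trans (modᶻ-reflexive (cong +_ eq)) (%-modᶻ (a + y) k))))

-- A row or a column of the array, read as d runs through a rotation of 0, …, k - 1: its partial
-- sums are G (ρ + x + 1) - G ρ, hence distinct because G is injective modulo M.
module Line {w M k : ℕ} .{{_ : NonZero k}} (M∣w : + M ∣ᶻ + w)
  (G : ℕ → ℤ) (G-closed : G k ≡ G 0)
  (G-injective : ∀ {a b} → a < k → b < k → G a ≡ G b [modᶻ + M ] → a ≡ b)
  (F : ℕ → Fin w) (F-step : ∀ {d} → d < k → + toℕ (F d) ≡ G (suc d) -ᶻ G d [modᶻ + w ]) (ρ : ℕ) where

  private
    H : ℕ → ℤ
    H x = G ((ρ + x) % k)

    b : ℕ → ℕ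
    b x = toℕ (F ((ρ + x) % k))

    G-wrap : ∀ a → G (suc (a % k)) ≡ G (suc a % k)
    G-wrap a with suc-%-cases a k
    ... | inj₁ eq        = cong G eq
    ... | inj₂ (eq , eq′) = trans (cong G eq) (trans G-closed (cong G (sym eq′)))

    step : ∀ x → + b x ≡ H (suc x) -ᶻ H x [modᶻ + w ]
    step x = modᶻ-trans (F-step (m%n<n (ρ + x) k))
      (modᶻ-reflexive (cong (_-ᶻ H x) (trans (G-wrap (ρ + x)) (cong (λ y → G (y % k)) (sym (ℕₚ.+-suc ρ x))))))

    entries≡ : map toℕ (map F (rotation k ρ)) ≡ applyUpTo b k
    entries≡ = trans (cong (map toℕ) (map-applyUpTo _ F k)) (map-applyUpTo _ toℕ k)

  length-line : length (map F (rotation k ρ)) ≡ k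
  length-line = trans (length-map F (rotation k ρ)) (length-applyUpTo _ k)

  sum-line : SumsToZero w (map F (rotation k ρ))
  sum-line = subst (λ xs → w ∣ sum xs) (sym entries≡) (modᶻ0⇒∣ (modᶻ-trans (telescope b H k (λ {x} _ → step x))
    (modᶻ-reflexive (trans (cong (_-ᶻ H 0) (cong G (trans ([m+n]%n≡m%n ρ k) (cong (_% k) (sym (ℕₚ.+-identityʳ ρ))))))
                           (ℤₚ.+-inverseʳ (H 0))))))

  simple-line : SimpleOrdering w (map F (rotation k ρ))
  simple-line = subst (λ xs → AllPairs _ (partialSums 0 xs)) (sym entries≡)
    (subst (AllPairs _) (sym (partialSums-applyUpTo 0 b k)) (AllPairs.applyUpTo⁺₁ _ k distinct))
    where
    distinct : ∀ {x y} → x < y → y < k → ¬ (sum (applyUpTo b (suc x)) ≡ sum (applyUpTo b (suc y)) [mod w ])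
    distinct {x} {y} x<y y<k eq = ℕₚ.<-irrefl (%-injective (suc ρ) (ℕₚ.<-trans x<y y<k) y<k H-eq) x<y
      where
      prefix : ∀ z → + sum (applyUpTo b z) ≡ H z -ᶻ H 0 [modᶻ + M ]
      prefix z = telescope b H z (λ {x} _ → modᶻ-divisor M∣w (step x))
      H-eq : (suc ρ + x) % k ≡ (suc ρ + y) % k
      H-eq = G-injective (m%n<n (suc ρ + x) k) (m%n<n (suc ρ + y) k)
        (subst₂ (λ a c → G (a % k) ≡ G (c % k) [modᶻ + M ]) (ℕₚ.+-suc ρ x) (ℕₚ.+-suc ρ y)
          (modᶻ-+-cancelʳ (-ᶻ H 0)
            (modᶻ-trans (modᶻ-sym (prefix (suc x))) (modᶻ-trans (modᶻ-divisor M∣w ([mod]⇒modᶻ eq)) (prefix (suc y))))))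

MaybeAny⇒ : ∀ {A : Set} {Q : A → Set} {m} → MaybeAny Q m → ∃ λ y → m ≡ just y × Q y
MaybeAny⇒ (just q) = _ , refl , q

mapMaybe⁻ : ∀ {A B : Set} {Q : B → Set} (f : A → Maybe B) xs → Any Q (mapMaybe f xs) → Any (MaybeAny Q) (map f xs)
mapMaybe⁻ f (x ∷ xs) p with f x | p
... | nothing | p′       = there (mapMaybe⁻ f xs p′)
... | just _  | here q   = here (just q)
... | just _  | there p′ = there (mapMaybe⁻ f xs p′)

module _ {n w : ℕ} (A : Array n w) {Q : Fin w → Set} where

  Any-allEntries⁻ : Any Q (allEntries A) → ∃ λ i → ∃ λ j → MaybeAny Q (A i j)
  Any-allEntries⁻ p =
    let i , in-row = Anyₚ.tabulate⁻ (Anyₚ.concatMap⁻ (rowEntries A) p)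
        j , in-cell = Anyₚ.tabulate⁻ (Anyₚ.map⁻ (mapMaybe⁻ (A i) (allFin n) in-row))
    in i , j , in-cell

  Any-allEntries⁺ : ∀ i j → MaybeAny Q (A i j) → Any Q (allEntries A)
  Any-allEntries⁺ i j q =
    Anyₚ.concatMap⁺ (rowEntries A) (Anyₚ.tabulate⁺ i (Anyₚ.mapMaybe⁺ (A i) (allFin n) (Anyₚ.map⁺ (Anyₚ.tabulate⁺ j q))))

-- Difference cycles

Δ : (ℕ → ℕ) → ℕ → ℤ
Δ P d = + P (suc d) -ᶻ + P d

record DifferenceCycle (k : ℕ) : Set where
  field
    P           : ℕ → ℕ
    closed      : P k ≡ P 0
    injective   : ∀ {a b} → a < k → b < k → + P a ≡ + P b [modᶻ + (2 * k + 1) ] → a ≡ b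
    Δ-nonzero   : ∀ {d} → d < k → ¬ Δ P d ≡ 0ℤ [modᶻ + (2 * k + 1) ]
    Δ-injective : ∀ {d e} → d < k → e < k → Δ P d ≡ Δ P e [modᶻ + (2 * k + 1) ] → d ≡ e
    Δ-covers    : ∀ x → ¬ + x ≡ 0ℤ [modᶻ + (2 * k + 1) ] →
                  ∃ λ d → d < k × (Δ P d ≡ + x [modᶻ + (2 * k + 1) ] ⊎ Δ P d ≡ -ᶻ + x [modᶻ + (2 * k + 1) ])

data EvenOdd : ℕ → Set where
  even : ∀ l → EvenOdd (l + l)
  odd  : ∀ l → EvenOdd (suc (l + l))

evenOdd : ∀ d → EvenOdd d
evenOdd zero = even zero
evenOdd (suc d) with evenOdd d
... | even l = odd l
... | odd  l = subst EvenOdd (cong suc (ℕₚ.+-suc l l)) (even (suc l))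

double≢suc-double : ∀ l l′ → l + l ≢ suc (l′ + l′)
double≢suc-double l l′ eq = ℕₚ.even≢odd l l′ (trans (2*≡ l) (trans eq (cong suc (sym (2*≡ l′)))))
  where
  2*≡ : ∀ l → 2 * l ≡ l + l
  2*≡ l = cong (λ y → l + y) (ℕₚ.+-identityʳ l)

double-injective : ∀ {l l′} → l + l ≡ l′ + l′ → l ≡ l′
double-injective {l} {l′} eq with ℕₚ.<-cmp l l′
... | tri< l<l′ _ _ = contradiction eq (ℕₚ.<⇒≢ (ℕₚ.+-mono-< l<l′ l<l′))
... | tri≈ _ l≡l′ _ = l≡l′
... | tri> _ _ l′<l = contradiction (sym eq) (ℕₚ.<⇒≢ (ℕₚ.+-mono-< l′<l l′<l))

module FromMagnitudes (k : ℕ) (P mag mag⁻¹ : ℕ → ℕ)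
  (closed      : P k ≡ P 0)
  (P<M         : ∀ {d} → d < k → P d < 2 * k + 1)
  (P-injective : ∀ {a b} → a < k → b < k → P a ≡ P b → a ≡ b)
  (mag-pos     : ∀ {d} → d < k → 1 ≤ mag d)
  (mag≤k       : ∀ {d} → d < k → mag d ≤ k)
  (mag⁻¹-mag   : ∀ {d} → d < k → mag⁻¹ (mag d) ≡ d)
  (mag-mag⁻¹   : ∀ {r} → 1 ≤ r → r ≤ k → mag (mag⁻¹ r) ≡ r)
  (mag⁻¹<k     : ∀ {r} → 1 ≤ r → r ≤ k → mag⁻¹ r < k)
  (Δ≡±mag      : ∀ {d} → d < k → Δ P d ≡ + mag d [modᶻ + (2 * k + 1) ] ⊎ Δ P d ≡ -ᶻ + mag d [modᶻ + (2 * k + 1) ])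
  where

  private
    M : ℕ
    M = 2 * k + 1

    instance
      M-nonZero : NonZero M
      M-nonZero = ℕ.>-nonZero (ℕₚ.m≤n+m 1 (2 * k))

    ≤k⇒<M : ∀ {a} → a ≤ k → a < M
    ≤k⇒<M {a} a≤k = subst (a <_) (ℕₚ.+-comm 1 (2 * k)) (s≤s (ℕₚ.≤-trans a≤k (ℕₚ.m≤m+n k (k + 0))))

    +≤2k⇒<M : ∀ {a b} → a ≤ k → b ≤ k → a + b < M
    +≤2k⇒<M {a} {b} a≤k b≤k = subst (a + b <_) (ℕₚ.+-comm 1 (2 * k))
      (s≤s (ℕₚ.≤-trans (ℕₚ.+-mono-≤ a≤k b≤k) (ℕₚ.≤-reflexive (cong (λ y → k + y) (sym (ℕₚ.+-identityʳ k))))))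

    mag<M : ∀ {d} → d < k → mag d < M
    mag<M d<k = ≤k⇒<M (mag≤k d<k)

    M≡0 : + M ≡ 0ℤ [modᶻ + M ]
    M≡0 = modᶻ (divides 1ℤ (trans (ℤₚ.+-identityʳ (+ M)) (sym (ℤₚ.*-identityˡ (+ M)))))

    by-magnitude : ∀ {r y} → 1 ≤ r → r ≤ k → + r ≡ y [modᶻ + M ] →
                   ∃ λ d → d < k × (Δ P d ≡ y [modᶻ + M ] ⊎ Δ P d ≡ -ᶻ y [modᶻ + M ])
    by-magnitude {r} {y} 1≤r r≤k r≡y = mag⁻¹ r , mag⁻¹<k 1≤r r≤k , sign (Δ≡±mag (mag⁻¹<k 1≤r r≤k))
      where
      mag≡y : + mag (mag⁻¹ r) ≡ y [modᶻ + M ]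
      mag≡y = modᶻ-trans (modᶻ-reflexive (cong +_ (mag-mag⁻¹ 1≤r r≤k))) r≡y
      sign : Δ P (mag⁻¹ r) ≡ + mag (mag⁻¹ r) [modᶻ + M ] ⊎ Δ P (mag⁻¹ r) ≡ -ᶻ + mag (mag⁻¹ r) [modᶻ + M ] →
             Δ P (mag⁻¹ r) ≡ y [modᶻ + M ] ⊎ Δ P (mag⁻¹ r) ≡ -ᶻ y [modᶻ + M ]
      sign (inj₁ Δ≡mag)  = inj₁ (modᶻ-trans Δ≡mag mag≡y)
      sign (inj₂ Δ≡-mag) = inj₂ (modᶻ-trans Δ≡-mag (modᶻ-neg mag≡y))

    mag-injective : ∀ {d e} → d < k → e < k → mag d ≡ mag e → d ≡ e
    mag-injective d<k e<k eq = trans (sym (mag⁻¹-mag d<k)) (trans (cong mag⁻¹ eq) (mag⁻¹-mag e<k))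

    -- ±mag d ≡ ∓mag e would make mag d + mag e a positive multiple of M below M.
    mag-not-opposite : ∀ {d e} → d < k → e < k → ¬ + mag d ≡ -ᶻ + mag e [modᶻ + M ]
    mag-not-opposite {d} {e} d<k e<k eq = ℕₚ.<⇒≢ (ℕₚ.+-mono-≤ (mag-pos d<k) (z≤n {mag e}))
      (sym (modᶻ⇒≡ (+≤2k⇒<M (mag≤k d<k) (mag≤k e<k)) (≤k⇒<M z≤n)
        (subst (_≡ 0ℤ [modᶻ + M ]) (sym (ℤₚ.pos-+ (mag d) (mag e)))
          (modᶻ-trans (modᶻ-+ eq (modᶻ-refl {a = + mag e})) (modᶻ-reflexive (ℤₚ.+-inverseˡ (+ mag e)))))))

  Δ-nonzero : ∀ {d} → d < k → ¬ Δ P d ≡ 0ℤ [modᶻ + M ]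
  Δ-nonzero {d} d<k Δ≡0 = ℕₚ.<⇒≢ (mag-pos d<k) (sym (modᶻ⇒≡ (mag<M d<k) (≤k⇒<M z≤n) mag≡0))
    where
    mag≡0 : + mag d ≡ 0ℤ [modᶻ + M ]
    mag≡0 with Δ≡±mag d<k
    ... | inj₁ Δ≡mag  = modᶻ-trans (modᶻ-sym Δ≡mag) Δ≡0
    ... | inj₂ Δ≡-mag = subst₂ (_≡_[modᶻ + M ]) (ℤₚ.neg-involutive _) refl (modᶻ-neg (modᶻ-trans (modᶻ-sym Δ≡-mag) Δ≡0))

  Δ-injective : ∀ {d e} → d < k → e < k → Δ P d ≡ Δ P e [modᶻ + M ] → d ≡ e
  Δ-injective {d} {e} d<k e<k Δd≡Δe with Δ≡±mag d<k | Δ≡±mag e<k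
  ... | inj₁ p | inj₁ p′ = mag-injective d<k e<k (modᶻ⇒≡ (mag<M d<k) (mag<M e<k)
                             (modᶻ-trans (modᶻ-sym p) (modᶻ-trans Δd≡Δe p′)))
  ... | inj₂ p | inj₂ p′ = mag-injective d<k e<k (modᶻ⇒≡ (mag<M d<k) (mag<M e<k)
                             (subst₂ (_≡_[modᶻ + M ]) (ℤₚ.neg-involutive _) (ℤₚ.neg-involutive _)
                               (modᶻ-neg (modᶻ-trans (modᶻ-sym p) (modᶻ-trans Δd≡Δe p′)))))
  ... | inj₁ p | inj₂ p′ = contradiction (modᶻ-trans (modᶻ-sym p) (modᶻ-trans Δd≡Δe p′)) (mag-not-opposite d<k e<k)
  ... | inj₂ p | inj₁ p′ = contradiction (modᶻ-trans (modᶻ-sym p′) (modᶻ-trans (modᶻ-sym Δd≡Δe) p)) (mag-not-opposite e<k d<k)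

  Δ-covers : ∀ x → ¬ + x ≡ 0ℤ [modᶻ + M ] →
             ∃ λ d → d < k × (Δ P d ≡ + x [modᶻ + M ] ⊎ Δ P d ≡ -ᶻ + x [modᶻ + M ])
  -- x ≡ r = x mod M with 0 < r; either r ≤ k is a magnitude, or M - r ≤ k is one and M - r ≡ -x.
  Δ-covers x x≢0 with x % M ≤? k
  ... | yes r≤k = by-magnitude r-pos r≤k (%-modᶻ x M)
    where
    r-pos : 1 ≤ x % M
    r-pos = ℕₚ.n≢0⇒n>0 (λ r≡0 → x≢0 (modᶻ-trans (modᶻ-sym (%-modᶻ x M)) (modᶻ-reflexive (cong +_ r≡0))))
  ... | no  r≰k = flip-sign (by-magnitude (ℕₚ.m<n⇒0<n∸m (m%n<n x M)) r′≤k r′≡-x)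
    where
    r = x % M
    r′≤k : M ∸ r ≤ k
    r′≤k = ℕₚ.m≤n+o⇒m∸n≤o M r (subst (_≤ r + k) (M≡1+k+k k) (ℕₚ.+-monoˡ-≤ k (ℕₚ.≰⇒> r≰k)))
      where
      M≡1+k+k : ∀ k → suc k + k ≡ 2 * k + 1
      M≡1+k+k = ℕ-Solver.solve-∀
    r′≡-x : + (M ∸ r) ≡ -ᶻ + x [modᶻ + M ]
    r′≡-x = begin
      + (M ∸ r)                  ≈⟨ modᶻ-+-cancelʳ (+ r) (begin
          + (M ∸ r) +ᶻ + r            ≡⟨ ℤₚ.pos-+ (M ∸ r) r ⟨
          + (M ∸ r + r)               ≡⟨ cong +_ (ℕₚ.m∸n+n≡m (ℕₚ.<⇒≤ (m%n<n x M))) ⟩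
          + M                         ≈⟨ M≡0 ⟩
          0ℤ                          ≡⟨ ℤₚ.+-inverseˡ (+ r) ⟨
          -ᶻ + r +ᶻ + r               ∎) ⟩
      -ᶻ + r                     ≈⟨ modᶻ-neg (%-modᶻ x M) ⟩
      -ᶻ + x                     ∎
      where open ≡-modᶻ-Reasoning (+ M)
    flip-sign : (∃ λ d → d < k × (Δ P d ≡ -ᶻ + x [modᶻ + M ] ⊎ Δ P d ≡ -ᶻ (-ᶻ + x) [modᶻ + M ])) →
                ∃ λ d → d < k × (Δ P d ≡ + x [modᶻ + M ] ⊎ Δ P d ≡ -ᶻ + x [modᶻ + M ])
    flip-sign (d , d<k , inj₁ Δ≡-x)  = d , d<k , inj₂ Δ≡-x
    flip-sign (d , d<k , inj₂ Δ≡--x) = d , d<k , inj₁ (subst (Δ P d ≡_[modᶻ + M ]) (ℤₚ.neg-involutive (+ x)) Δ≡--x)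

  cycle : DifferenceCycle k
  cycle = record
    { P           = P
    ; closed      = closed
    ; injective   = λ a<k b<k Pa≡Pb → P-injective a<k b<k (modᶻ⇒≡ (P<M a<k) (P<M b<k) Pa≡Pb)
    ; Δ-nonzero   = Δ-nonzero
    ; Δ-injective = Δ-injective
    ; Δ-covers    = Δ-covers
    }

module Magnitudes (t : ℕ) (1≤t : 1 ≤ t) where

  k : ℕ
  k = suc (t + t)

  mag : ℕ → ℕ
  mag d with d <? t | d <? t + t
  ... | yes _ | _     = k ∸ d
  ... | no  _ | yes _ = t + t ∸ d
  ... | no  _ | no  _ = suc t

  mag⁻¹ : ℕ → ℕ
  mag⁻¹ r with suc t <? r | r <? suc t
  ... | yes _ | _     = k ∸ r
  ... | no  _ | yes _ = t + t ∸ r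
  ... | no  _ | no  _ = t + t

  mag-low : ∀ {d} → d < t → mag d ≡ k ∸ d
  mag-low {d} d<t with d <? t | d <? t + t
  ... | yes _   | _ = refl
  ... | no  d≮t | _ = contradiction d<t d≮t

  mag-mid : ∀ {d} → t ≤ d → d < t + t → mag d ≡ t + t ∸ d
  mag-mid {d} t≤d d<2t with d <? t | d <? t + t
  ... | yes d<t | _        = contradiction t≤d (ℕₚ.<⇒≱ d<t)
  ... | no  _   | yes _    = refl
  ... | no  _   | no  d≮2t = contradiction d<2t d≮2t

  mag-top : mag (t + t) ≡ suc t
  mag-top with t + t <? t | t + t <? t + t
  ... | yes 2t<t | _       = contradiction 2t<t (ℕₚ.≤⇒≯ (ℕₚ.m≤m+n t t))
  ... | no  _    | yes 2t<2t = contradiction 2t<2t (ℕₚ.<-irrefl refl)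
  ... | no  _    | no  _   = refl

  mag⁻¹-high : ∀ {r} → suc t < r → mag⁻¹ r ≡ k ∸ r
  mag⁻¹-high {r} t+1<r with suc t <? r | r <? suc t
  ... | yes _     | _ = refl
  ... | no  t+1≮r | _ = contradiction t+1<r t+1≮r

  mag⁻¹-low : ∀ {r} → r < suc t → mag⁻¹ r ≡ t + t ∸ r
  mag⁻¹-low {r} r<t+1 with suc t <? r | r <? suc t
  ... | yes t+1<r | _       = contradiction r<t+1 (ℕₚ.<⇒≯ t+1<r)
  ... | no  _     | yes _   = refl
  ... | no  _     | no  r≮t+1 = contradiction r<t+1 r≮t+1

  mag⁻¹-mid : mag⁻¹ (suc t) ≡ t + t
  mag⁻¹-mid with suc t <? suc t | suc t <? suc t
  ... | yes t+1<t+1 | _ = contradiction t+1<t+1 (ℕₚ.<-irrefl refl)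
  ... | no  _ | yes t+1<t+1 = contradiction t+1<t+1 (ℕₚ.<-irrefl refl)
  ... | no  _ | no  _ = refl

  region : ∀ d → d < t ⊎ (t ≤ d × d < t + t) ⊎ t + t ≤ d
  region d with d <? t | d <? t + t
  ... | yes d<t | _        = inj₁ d<t
  ... | no  d≮t | yes d<2t = inj₂ (inj₁ (ℕₚ.≮⇒≥ d≮t , d<2t))
  ... | no  _   | no  d≮2t = inj₂ (inj₂ (ℕₚ.≮⇒≥ d≮2t))

  private
    instance
      t-nonZero : NonZero t
      t-nonZero = ℕ.>-nonZero 1≤t

  2t≤d⇒d≡2t : ∀ {d} → d < k → t + t ≤ d → d ≡ t + t
  2t≤d⇒d≡2t (s≤s d≤2t) 2t≤d = ℕₚ.≤-antisym d≤2t 2t≤d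

  k∸low>t+1 : ∀ {d} → d < t → suc t < k ∸ d
  k∸low>t+1 {d} d<t = ℕₚ.m+n≤o⇒m≤o∸n (suc (suc t)) (s≤s (subst (_≤ t + t) (ℕₚ.+-suc t d) (ℕₚ.+-monoʳ-≤ t d<t)))

  2t∸mid≤t : ∀ {d} → t ≤ d → t + t ∸ d < suc t
  2t∸mid≤t {d} t≤d = s≤s (ℕₚ.≤-trans (ℕₚ.∸-monoʳ-≤ (t + t) t≤d) (ℕₚ.≤-reflexive (ℕₚ.m+n∸n≡m t t)))

  k∸high<t : ∀ {r} → suc t < r → k ∸ r < t
  k∸high<t {r} t+1<r = ℕₚ.m<n+o⇒m∸n<o k r (ℕₚ.+-monoˡ-≤ t t+1<r)

  mag⁻¹-mag : ∀ {d} → d < k → mag⁻¹ (mag d) ≡ d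
  mag⁻¹-mag {d} d<k with region d
  ... | inj₁ d<t = begin
    mag⁻¹ (mag d)          ≡⟨ cong mag⁻¹ (mag-low d<t) ⟩
    mag⁻¹ (k ∸ d)          ≡⟨ mag⁻¹-high (k∸low>t+1 d<t) ⟩
    k ∸ (k ∸ d)            ≡⟨ ℕₚ.m∸[m∸n]≡n (ℕₚ.<⇒≤ d<k) ⟩
    d                      ∎
    where open ≡-Reasoning
  ... | inj₂ (inj₁ (t≤d , d<2t)) = begin
    mag⁻¹ (mag d)          ≡⟨ cong mag⁻¹ (mag-mid t≤d d<2t) ⟩
    mag⁻¹ (t + t ∸ d)      ≡⟨ mag⁻¹-low (2t∸mid≤t t≤d) ⟩
    t + t ∸ (t + t ∸ d)    ≡⟨ ℕₚ.m∸[m∸n]≡n (ℕₚ.<⇒≤ d<2t) ⟩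
    d                      ∎
    where open ≡-Reasoning
  ... | inj₂ (inj₂ 2t≤d) rewrite 2t≤d⇒d≡2t d<k 2t≤d = trans (cong mag⁻¹ mag-top) mag⁻¹-mid

  mag-mag⁻¹ : ∀ {r} → 1 ≤ r → r ≤ k → mag (mag⁻¹ r) ≡ r
  mag-mag⁻¹ {r} 1≤r r≤k with ℕₚ.<-cmp (suc t) r
  ... | tri< t+1<r _ _ = begin
    mag (mag⁻¹ r)          ≡⟨ cong mag (mag⁻¹-high t+1<r) ⟩
    mag (k ∸ r)            ≡⟨ mag-low (k∸high<t t+1<r) ⟩
    k ∸ (k ∸ r)            ≡⟨ ℕₚ.m∸[m∸n]≡n r≤k ⟩
    r                      ∎
    where open ≡-Reasoning
  ... | tri> _ _ r<t+1 = begin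
    mag (mag⁻¹ r)          ≡⟨ cong mag (mag⁻¹-low r<t+1) ⟩
    mag (t + t ∸ r)        ≡⟨ mag-mid t≤2t∸r (ℕₚ.∸-monoʳ-< 1≤r r≤2t) ⟩
    t + t ∸ (t + t ∸ r)    ≡⟨ ℕₚ.m∸[m∸n]≡n r≤2t ⟩
    r                      ∎
    where
    open ≡-Reasoning
    r≤2t : r ≤ t + t
    r≤2t = ℕₚ.≤-trans (s≤s⁻¹ r<t+1) (ℕₚ.m≤m+n t t)
    t≤2t∸r : t ≤ t + t ∸ r
    t≤2t∸r = ℕₚ.m+n≤o⇒m≤o∸n t (ℕₚ.+-monoʳ-≤ t (s≤s⁻¹ r<t+1))
  ... | tri≈ _ refl _ = trans (cong mag mag⁻¹-mid) mag-top

  mag-pos : ∀ {d} → d < k → 1 ≤ mag d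
  mag-pos {d} d<k with region d
  ... | inj₁ d<t                 = subst (1 ≤_) (sym (mag-low d<t)) (ℕₚ.m<n⇒0<n∸m d<k)
  ... | inj₂ (inj₁ (t≤d , d<2t)) = subst (1 ≤_) (sym (mag-mid t≤d d<2t)) (ℕₚ.m<n⇒0<n∸m d<2t)
  ... | inj₂ (inj₂ 2t≤d) rewrite 2t≤d⇒d≡2t d<k 2t≤d = subst (1 ≤_) (sym mag-top) (s≤s z≤n)

  mag≤k : ∀ {d} → d < k → mag d ≤ k
  mag≤k {d} d<k with region d
  ... | inj₁ d<t                 = subst (_≤ k) (sym (mag-low d<t)) (ℕₚ.m∸n≤m k d)
  ... | inj₂ (inj₁ (t≤d , d<2t)) = subst (_≤ k) (sym (mag-mid t≤d d<2t)) (ℕₚ.≤-trans (ℕₚ.m∸n≤m (t + t) d) (ℕₚ.n≤1+n _))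
  ... | inj₂ (inj₂ 2t≤d) rewrite 2t≤d⇒d≡2t d<k 2t≤d = subst (_≤ k) (sym mag-top) (s≤s (ℕₚ.m≤m+n t t))

  mag⁻¹<k : ∀ {r} → 1 ≤ r → r ≤ k → mag⁻¹ r < k
  mag⁻¹<k {r} 1≤r r≤k with ℕₚ.<-cmp (suc t) r
  ... | tri< t+1<r _ _ = subst (_< k) (sym (mag⁻¹-high t+1<r)) (ℕₚ.<-trans (k∸high<t t+1<r) (s≤s (ℕₚ.m≤m+n t t)))
  ... | tri> _ _ r<t+1 = subst (_< k) (sym (mag⁻¹-low r<t+1)) (s≤s (ℕₚ.m∸n≤m (t + t) r))
  ... | tri≈ _ refl _  = subst (_< k) (sym mag⁻¹-mid) (ℕₚ.n<1+n (t + t))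

𝟙 : ∀ {A : Set} → Dec A → ℕ
𝟙 (yes _) = 1
𝟙 (no  _) = 0

𝟙-yes : ∀ {A : Set} (a? : Dec A) → A → 𝟙 a? ≡ 1
𝟙-yes (yes _) _ = refl
𝟙-yes (no ¬a) a = contradiction a ¬a

𝟙-no : ∀ {A : Set} (a? : Dec A) → ¬ A → 𝟙 a? ≡ 0
𝟙-no (yes a) ¬a = contradiction a ¬a
𝟙-no (no  _) _  = refl

𝟙≤1 : ∀ {A : Set} (a? : Dec A) → 𝟙 a? ≤ 1
𝟙≤1 (yes _) = s≤s z≤n
𝟙≤1 (no  _) = z≤n

+𝟙-injective : ∀ {Q : ℕ → Set} (Q? : ∀ l → Dec (Q l)) → (∀ {x y} → x ≤ y → Q x → Q y) →
               ∀ {l l′} → l + 𝟙 (Q? l) ≡ l′ + 𝟙 (Q? l′) → l ≡ l′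
+𝟙-injective Q? upward {l} {l′} eq with Q? l | Q? l′
... | yes _ | yes _ = ℕₚ.+-cancelʳ-≡ 1 l l′ eq
... | no  _ | no  _ = ℕₚ.+-cancelʳ-≡ 0 l l′ eq
... | yes q | no ¬q′ = contradiction (upward (ℕₚ.≤-trans (ℕₚ.n≤1+n l) (subst (suc l ≤_) (ℕₚ.+-identityʳ l′)
                                        (subst (_≤ l′ + 0) (ℕₚ.+-comm l 1) (ℕₚ.≤-reflexive eq)))) q) ¬q′
... | no ¬q | yes q′ = contradiction (upward (ℕₚ.≤-trans (ℕₚ.n≤1+n l′) (subst (suc l′ ≤_) (ℕₚ.+-identityʳ l)
                                        (subst (_≤ l + 0) (ℕₚ.+-comm l′ 1) (ℕₚ.≤-reflexive (sym eq))))) q′) ¬q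

interleave : (ℕ → ℕ) → (ℕ → ℕ) → ℕ → ℕ
interleave e o zero    = e 0
interleave e o (suc d) = interleave o (e ∘ suc) d

interleave-even : ∀ e o l → interleave e o (l + l) ≡ e l
interleave-even e o zero    = refl
interleave-even e o (suc l) = trans (cong (interleave e o ∘ suc) (ℕₚ.+-suc l l)) (interleave-even (e ∘ suc) (o ∘ suc) l)

interleave-odd : ∀ e o l → interleave e o (suc (l + l)) ≡ o l
interleave-odd e o = interleave-even o (e ∘ suc)

-- The k-periodic sequence pe 0, po 0, pe 1, po 1, …, pe t, pe 0, … with k = 2t + 1.
module Zigzag (t : ℕ) (pe po : ℕ → ℕ) where

  k : ℕ
  k = suc (t + t)

  P : ℕ → ℕ
  P d = interleave pe po (d % k)

  P-even : ∀ l → l + l < k → P (l + l) ≡ pe l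
  P-even l 2l<k = trans (cong (interleave pe po) (m<n⇒m%n≡m 2l<k)) (interleave-even pe po l)

  P-odd : ∀ l → suc (l + l) < k → P (suc (l + l)) ≡ po l
  P-odd l 2l+1<k = trans (cong (interleave pe po) (m<n⇒m%n≡m 2l+1<k)) (interleave-odd pe po l)

  P-closed : P k ≡ P 0
  P-closed = cong (interleave pe po) (n%n≡0 k)

  Δ-even : ∀ l → suc (l + l) < k → Δ P (l + l) ≡ + po l -ᶻ + pe l
  Δ-even l 2l+1<k = cong₂ (λ a b → + a -ᶻ + b) (P-odd l 2l+1<k) (P-even l (ℕₚ.<-trans (ℕₚ.n<1+n _) 2l+1<k))

  Δ-odd : ∀ l → suc (suc (l + l)) < k → Δ P (suc (l + l)) ≡ + pe (suc l) -ᶻ + po l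
  Δ-odd l 2l+2<k = cong₂ (λ a b → + a -ᶻ + b)
    (trans (cong (P ∘ suc) (sym (ℕₚ.+-suc l l))) (P-even (suc l) (subst (_< k) (cong suc (sym (ℕₚ.+-suc l l))) 2l+2<k)))
    (P-odd l (ℕₚ.<-trans (ℕₚ.n<1+n _) 2l+2<k))

  Δ-last : Δ P (t + t) ≡ + pe 0 -ᶻ + pe t
  Δ-last = cong₂ (λ a b → + a -ᶻ + b) (trans P-closed (P-even 0 (s≤s z≤n))) (P-even t (ℕₚ.n<1+n (t + t)))

  half-even : ∀ l → l + l < k → l ≤ t
  half-even l 2l<k = ℕₚ.≮⇒≥ (λ t<l → ℕₚ.<⇒≱ (ℕₚ.+-mono-< t<l t<l) (s≤s⁻¹ 2l<k))

  half-odd : ∀ l → suc (l + l) < k → l < t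
  half-odd l 2l+1<k = ℕₚ.≰⇒> (λ t≤l → ℕₚ.<⇒≱ (s≤s⁻¹ 2l+1<k) (ℕₚ.+-mono-≤ t≤l t≤l))

  module Bounded (pe≤ : ∀ {l} → l ≤ t → pe l ≤ suc t) (po≥ : ∀ {l} → l < t → suc (suc t) ≤ po l)
                 (po≤ : ∀ {l} → l < t → po l ≤ suc k)
                 (pe-injective : ∀ {l l′} → pe l ≡ pe l′ → l ≡ l′)
                 (po-injective : ∀ {l l′} → l < t → l′ < t → po l ≡ po l′ → l ≡ l′) where

    k+1<M : suc k < 2 * k + 1
    k+1<M = subst (suc k <_) (sym (M≡ k)) (s≤s (subst (_≤ k + k) (ℕₚ.+-comm k 1) (ℕₚ.+-monoʳ-≤ k (s≤s z≤n))))
      where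
      M≡ : ∀ k → 2 * k + 1 ≡ suc (k + k)
      M≡ = ℕ-Solver.solve-∀

    P<M : ∀ {d} → d < k → P d < 2 * k + 1
    P<M {d} d<k with evenOdd d
    ... | even l = subst (_< 2 * k + 1) (sym (P-even l d<k))
                         (ℕₚ.≤-<-trans (pe≤ (half-even l d<k)) (ℕₚ.<-trans (s≤s (s≤s (ℕₚ.m≤m+n t t))) k+1<M))
    ... | odd  l = subst (_< 2 * k + 1) (sym (P-odd l d<k)) (ℕₚ.≤-<-trans (po≤ (half-odd l d<k)) k+1<M)

    P-injective : ∀ {a b} → a < k → b < k → P a ≡ P b → a ≡ b
    P-injective {a} {b} a<k b<k Pa≡Pb with evenOdd a | evenOdd b
    ... | even l | even l′ = cong (λ x → x + x) (pe-injective (trans (sym (P-even l a<k)) (trans Pa≡Pb (P-even l′ b<k))))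
    ... | odd  l | odd  l′ = cong (λ x → suc (x + x))
                               (po-injective (half-odd l a<k) (half-odd l′ b<k) (trans (sym (P-odd l a<k)) (trans Pa≡Pb (P-odd l′ b<k))))
    ... | even l | odd  l′ = contradiction (trans (sym (P-even l a<k)) (trans Pa≡Pb (P-odd l′ b<k)))
                               (ℕₚ.<⇒≢ (ℕₚ.<-≤-trans (s≤s (pe≤ (half-even l a<k))) (po≥ (half-odd l′ b<k))))
    ... | odd  l | even l′ = contradiction (trans (sym (P-odd l a<k)) (trans Pa≡Pb (P-even l′ b<k)))
                               (ℕₚ.<⇒≢ (ℕₚ.<-≤-trans (s≤s (pe≤ (half-even l′ b<k))) (po≥ (half-odd l a<k))) ∘ sym)

module OddHalf (m : ℕ) where

  t : ℕ
  t = suc (m + m)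

  open Magnitudes t (s≤s z≤n)

  pe po : ℕ → ℕ
  pe l = l + 𝟙 (t <? l + l)
  po l = k ∸ l

  open Zigzag t pe po hiding (k)

  pe≤ : ∀ {l} → l ≤ t → pe l ≤ suc t
  pe≤ {l} l≤t = subst (pe l ≤_) (ℕₚ.+-comm t 1) (ℕₚ.+-mono-≤ l≤t (𝟙≤1 (t <? l + l)))

  po≤ : ∀ {l} → l < t → po l ≤ suc k
  po≤ {l} _ = ℕₚ.≤-trans (ℕₚ.m∸n≤m k l) (ℕₚ.n≤1+n k)

  pe-injective : ∀ {l l′} → pe l ≡ pe l′ → l ≡ l′
  pe-injective = +𝟙-injective (λ l → t <? l + l) (λ x≤y t<2x → ℕₚ.<-≤-trans t<2x (ℕₚ.+-mono-≤ x≤y x≤y))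

  po-injective : ∀ {l l′} → l < t → l′ < t → po l ≡ po l′ → l ≡ l′
  po-injective l<t l′<t = ℕₚ.∸-cancelˡ-≡ (ℕₚ.<⇒≤ (ℕₚ.<-trans l<t t<k)) (ℕₚ.<⇒≤ (ℕₚ.<-trans l′<t t<k))
    where t<k = s≤s (ℕₚ.m≤m+n t t)

  open Bounded pe≤ k∸low>t+1 po≤ pe-injective po-injective

  Δ-top : Δ P (t + t) ≡ -ᶻ + mag (t + t)
  Δ-top = begin
    Δ P (t + t)
      ≡⟨ Δ-last ⟩
    + pe 0 -ᶻ + (t + 𝟙 (t <? t + t))
      ≡⟨ cong₂ (λ a b → + a -ᶻ + (t + b)) (𝟙-no (t <? 0) λ ()) (𝟙-yes (t <? t + t) (ℕₚ.m<m+n t (s≤s z≤n))) ⟩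
    -ᶻ + (t + 1)
      ≡⟨ cong (λ x → -ᶻ + x) (trans (ℕₚ.+-comm t 1) (sym mag-top)) ⟩
    -ᶻ + mag (t + t) ∎
    where open ≡-Reasoning

  -- The ring identities below are instantiated at + t, where + k computes to 1ℤ +ᶻ (+ t +ᶻ + t).
  Δ≡±mag : ∀ {d} → d < k → Δ P d ≡ + mag d ⊎ Δ P d ≡ -ᶻ + mag d
  Δ≡±mag {d} d<k with evenOdd d | region d
  ... | even l | inj₁ 2l<t = inj₁ (begin
    Δ P (l + l)
      ≡⟨ Δ-even l (s≤s (ℕₚ.<-≤-trans 2l<t (ℕₚ.m≤m+n t t))) ⟩
    + (k ∸ l) -ᶻ + (l + 𝟙 (t <? l + l))
      ≡⟨ cong₂ (λ a b → a -ᶻ + (l + b)) (pos-∸ l≤k) (𝟙-no (t <? l + l) (ℕₚ.<⇒≯ 2l<t)) ⟩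
    (+ k -ᶻ + l) -ᶻ + (l + 0)
      ≡⟨ regroup (+ k) (+ l) ⟩
    + k -ᶻ + (l + l)
      ≡⟨ pos-∸ (ℕₚ.<⇒≤ d<k) ⟨
    + (k ∸ (l + l))
      ≡⟨ cong +_ (mag-low 2l<t) ⟨
    + mag (l + l) ∎)
    where
    open ≡-Reasoning
    l≤k = ℕₚ.≤-trans (ℕₚ.m≤m+n l l) (ℕₚ.<⇒≤ d<k)
    regroup : ∀ K L → (K -ᶻ L) -ᶻ (L +ᶻ 0ℤ) ≡ K -ᶻ (L +ᶻ L)
    regroup = solve-∀
  ... | even l | inj₂ (inj₁ (t≤2l , 2l<2t)) = inj₁ (begin
    Δ P (l + l)
      ≡⟨ Δ-even l (s≤s 2l<2t) ⟩
    + (k ∸ l) -ᶻ + (l + 𝟙 (t <? l + l))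
      ≡⟨ cong₂ (λ a b → a -ᶻ + (l + b)) (pos-∸ l≤k) (𝟙-yes (t <? l + l) t<2l) ⟩
    (+ k -ᶻ + l) -ᶻ + (l + 1)
      ≡⟨ regroup (+ t) (+ l) ⟩
    + (t + t) -ᶻ + (l + l)
      ≡⟨ pos-∸ (ℕₚ.<⇒≤ 2l<2t) ⟨
    + (t + t ∸ (l + l))
      ≡⟨ cong +_ (mag-mid t≤2l 2l<2t) ⟨
    + mag (l + l) ∎)
    where
    open ≡-Reasoning
    l≤k = ℕₚ.≤-trans (ℕₚ.m≤m+n l l) (ℕₚ.<⇒≤ d<k)
    t<2l : t < l + l
    t<2l with ℕₚ.m≤n⇒m<n∨m≡n t≤2l
    ... | inj₁ t<2l = t<2l
    ... | inj₂ t≡2l = contradiction (sym t≡2l) (double≢suc-double l m)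
    regroup : ∀ T L → ((1ℤ +ᶻ (T +ᶻ T)) -ᶻ L) -ᶻ (L +ᶻ 1ℤ) ≡ (T +ᶻ T) -ᶻ (L +ᶻ L)
    regroup = solve-∀
  ... | even l | inj₂ (inj₂ 2t≤2l) =
    subst (λ x → Δ P (x + x) ≡ + mag (x + x) ⊎ Δ P (x + x) ≡ -ᶻ + mag (x + x)) {t} {l}
          (sym (double-injective (2t≤d⇒d≡2t d<k 2t≤2l))) (inj₂ Δ-top)
  ... | odd l | inj₁ 2l+1<t = inj₂ (begin
    Δ P (suc (l + l))
      ≡⟨ Δ-odd l (ℕₚ.<-≤-trans (s≤s 2l+1<t) (s≤s (ℕₚ.m≤m+n t t))) ⟩
    + (suc l + 𝟙 (t <? suc l + suc l)) -ᶻ + (k ∸ l)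
      ≡⟨ cong₂ (λ b a → + (suc l + b) -ᶻ a) (𝟙-no (t <? suc l + suc l) t≮2l+2) (pos-∸ l≤k) ⟩
    + (suc l + 0) -ᶻ (+ k -ᶻ + l)
      ≡⟨ regroup (+ k) (+ l) ⟩
    -ᶻ (+ k -ᶻ + suc (l + l))
      ≡⟨ cong -ᶻ_ (pos-∸ (ℕₚ.<⇒≤ d<k)) ⟨
    -ᶻ + (k ∸ suc (l + l))
      ≡⟨ cong (λ x → -ᶻ + x) (mag-low 2l+1<t) ⟨
    -ᶻ + mag (suc (l + l)) ∎)
    where
    open ≡-Reasoning
    l≤k = ℕₚ.≤-trans (ℕₚ.m≤m+n l l) (ℕₚ.≤-trans (ℕₚ.n≤1+n _) (ℕₚ.<⇒≤ d<k))
    t≮2l+2 : ¬ t < suc l + suc l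
    t≮2l+2 = ℕₚ.≤⇒≯ (subst (_≤ t) (cong suc (sym (ℕₚ.+-suc l l))) 2l+1<t)
    regroup : ∀ K L → (1ℤ +ᶻ (L +ᶻ 0ℤ)) -ᶻ (K -ᶻ L) ≡ -ᶻ (K -ᶻ (1ℤ +ᶻ (L +ᶻ L)))
    regroup = solve-∀
  ... | odd l | inj₂ (inj₁ (t≤2l+1 , 2l+1<2t)) = inj₂ (begin
    Δ P (suc (l + l))
      ≡⟨ Δ-odd l (s≤s 2l+1<2t) ⟩
    + (suc l + 𝟙 (t <? suc l + suc l)) -ᶻ + (k ∸ l)
      ≡⟨ cong₂ (λ b a → + (suc l + b) -ᶻ a) (𝟙-yes (t <? suc l + suc l) t<2l+2) (pos-∸ l≤k) ⟩
    + (suc l + 1) -ᶻ (+ k -ᶻ + l)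
      ≡⟨ regroup (+ t) (+ l) ⟩
    -ᶻ (+ (t + t) -ᶻ + suc (l + l))
      ≡⟨ cong -ᶻ_ (pos-∸ (ℕₚ.<⇒≤ 2l+1<2t)) ⟨
    -ᶻ + (t + t ∸ suc (l + l))
      ≡⟨ cong (λ x → -ᶻ + x) (mag-mid t≤2l+1 2l+1<2t) ⟨
    -ᶻ + mag (suc (l + l)) ∎)
    where
    open ≡-Reasoning
    l≤k = ℕₚ.≤-trans (ℕₚ.m≤m+n l l) (ℕₚ.≤-trans (ℕₚ.n≤1+n _) (ℕₚ.<⇒≤ d<k))
    t<2l+2 : t < suc l + suc l
    t<2l+2 = subst (t <_) (cong suc (sym (ℕₚ.+-suc l l))) (s≤s t≤2l+1)
    regroup : ∀ T L → (1ℤ +ᶻ (L +ᶻ 1ℤ)) -ᶻ ((1ℤ +ᶻ (T +ᶻ T)) -ᶻ L) ≡ -ᶻ ((T +ᶻ T) -ᶻ (1ℤ +ᶻ (L +ᶻ L)))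
    regroup = solve-∀
  ... | odd l | inj₂ (inj₂ 2t≤2l+1) = contradiction (sym (2t≤d⇒d≡2t d<k 2t≤2l+1)) (double≢suc-double t l)

  cycle : DifferenceCycle k
  cycle = FromMagnitudes.cycle k P mag mag⁻¹ P-closed P<M P-injective mag-pos mag≤k mag⁻¹-mag mag-mag⁻¹ mag⁻¹<k
    (Sum.map modᶻ-reflexive modᶻ-reflexive ∘ Δ≡±mag)

module EvenHalf (m : ℕ) where

  t : ℕ
  t = suc m + suc m

  open Magnitudes t (s≤s z≤n)

  pe po : ℕ → ℕ
  pe l = l + 𝟙 (0 <? l)
  po l = suc k ∸ l ∸ 𝟙 (t <? suc (l + l))

  open Zigzag t pe po hiding (k)

  pe≤ : ∀ {l} → l ≤ t → pe l ≤ suc t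
  pe≤ {l} l≤t = subst (pe l ≤_) (ℕₚ.+-comm t 1) (ℕₚ.+-mono-≤ l≤t (𝟙≤1 (0 <? l)))

  po≥ : ∀ {l} → l < t → suc (suc t) ≤ po l
  po≥ {l} l<t = ℕₚ.≤-trans (k∸low>t+1 l<t) (subst (_≤ po l) (trans (ℕₚ.∸-+-assoc (suc k) l 1) (cong (suc k ∸_) (ℕₚ.+-comm l 1)))
                                                   (ℕₚ.∸-monoʳ-≤ (suc k ∸ l) (𝟙≤1 (t <? suc (l + l)))))

  po≤ : ∀ {l} → l < t → po l ≤ suc k
  po≤ {l} _ = ℕₚ.≤-trans (ℕₚ.m∸n≤m (suc k ∸ l) (𝟙 (t <? suc (l + l)))) (ℕₚ.m∸n≤m (suc k) l)

  pe-injective : ∀ {l l′} → pe l ≡ pe l′ → l ≡ l′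
  pe-injective = +𝟙-injective (λ l → 0 <? l) (λ x≤y 0<x → ℕₚ.<-≤-trans 0<x x≤y)

  po-injective : ∀ {l l′} → l < t → l′ < t → po l ≡ po l′ → l ≡ l′
  po-injective {l} {l′} l<t l′<t eq = +𝟙-injective (λ l → t <? suc (l + l))
    (λ x≤y t<2x+1 → ℕₚ.<-≤-trans t<2x+1 (s≤s (ℕₚ.+-mono-≤ x≤y x≤y)))
    (ℕₚ.∸-cancelˡ-≡ (bound l<t) (bound l′<t)
      (trans (sym (ℕₚ.∸-+-assoc (suc k) l _)) (trans eq (ℕₚ.∸-+-assoc (suc k) l′ _))))
    where
    bound : ∀ {x} → x < t → x + 𝟙 (t <? suc (x + x)) ≤ suc k
    bound {x} x<t = ℕₚ.≤-trans (ℕₚ.+-mono-≤ (ℕₚ.<⇒≤ x<t) (𝟙≤1 _)) (ℕₚ.≤-trans (ℕₚ.≤-reflexive (ℕₚ.+-comm t 1))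
                                                                      (s≤s (ℕₚ.≤-trans (ℕₚ.m≤m+n t t) (ℕₚ.n≤1+n _))))

  open Bounded pe≤ po≥ po≤ pe-injective po-injective

  Δ-top : Δ P (t + t) ≡ -ᶻ + mag (t + t)
  Δ-top = begin
    Δ P (t + t)
      ≡⟨ Δ-last ⟩
    + pe 0 -ᶻ + (t + 𝟙 (0 <? t))
      ≡⟨ cong (λ b → + pe 0 -ᶻ + (t + b)) (𝟙-yes (0 <? t) (s≤s z≤n)) ⟩
    -ᶻ + (t + 1)
      ≡⟨ cong (λ x → -ᶻ + x) (trans (ℕₚ.+-comm t 1) (sym mag-top)) ⟩
    -ᶻ + mag (t + t) ∎
    where open ≡-Reasoning

  -- The first step is k + 1, which is -k modulo 2k + 1.
  Δ-first : Δ P 0 ≡ -ᶻ + mag 0 [modᶻ + (2 * k + 1) ]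
  Δ-first = subst₂ (_≡_[modᶻ + (2 * k + 1) ]) (sym Δ≡) (cong (λ x → -ᶻ + x) (sym (mag-low (s≤s z≤n))))
    (modᶻ (divides 1ℤ (wrap (+ k))))
    where
    Δ≡ : Δ P 0 ≡ + suc k -ᶻ 0ℤ
    Δ≡ = trans (Δ-even 0 (s≤s (s≤s z≤n))) (cong (λ a → + (suc k ∸ a) -ᶻ + pe 0) (𝟙-no (t <? 1) (λ { (s≤s ()) })))
    wrap : ∀ K → ((1ℤ +ᶻ K) -ᶻ 0ℤ) -ᶻ (-ᶻ K) ≡ 1ℤ *ᶻ ((K +ᶻ (K +ᶻ 0ℤ)) +ᶻ 1ℤ)
    wrap = solve-∀

  Δ≡±mag : ∀ {d} → d < k → Δ P d ≡ + mag d [modᶻ + (2 * k + 1) ] ⊎ Δ P d ≡ -ᶻ + mag d [modᶻ + (2 * k + 1) ]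
  Δ≡±mag {d} d<k with evenOdd d | region d
  ... | even zero    | _ = inj₂ Δ-first
  ... | even (suc l) | inj₁ d<t = inj₁ (modᶻ-reflexive (begin
    Δ P (suc l + suc l)
      ≡⟨ Δ-even (suc l) (s≤s (ℕₚ.<-≤-trans d<t (ℕₚ.m≤m+n t t))) ⟩
    + (k ∸ l ∸ 𝟙 (t <? suc (suc l + suc l))) -ᶻ + (suc l + 𝟙 (0 <? suc l))
      ≡⟨ cong₂ (λ a b → + (k ∸ l ∸ a) -ᶻ + (suc l + b)) (𝟙-no (t <? suc (suc l + suc l)) (ℕₚ.<⇒≱ d<t ∘ s≤s⁻¹)) (𝟙-yes (0 <? suc l) (s≤s z≤n)) ⟩
    + (k ∸ l) -ᶻ + (suc l + 1)
      ≡⟨ cong (_-ᶻ + (suc l + 1)) (pos-∸ l≤k) ⟩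
    (+ k -ᶻ + l) -ᶻ + (suc l + 1)
      ≡⟨ regroup (+ k) (+ l) ⟩
    + k -ᶻ + (suc l + suc l)
      ≡⟨ pos-∸ (ℕₚ.<⇒≤ d<k) ⟨
    + (k ∸ (suc l + suc l))
      ≡⟨ cong +_ (mag-low d<t) ⟨
    + mag (suc l + suc l) ∎))
    where
    open ≡-Reasoning
    l≤k = ℕₚ.≤-trans (ℕₚ.n≤1+n l) (ℕₚ.≤-trans (ℕₚ.m≤m+n (suc l) (suc l)) (ℕₚ.<⇒≤ d<k))
    regroup : ∀ K L → (K -ᶻ L) -ᶻ ((1ℤ +ᶻ L) +ᶻ 1ℤ) ≡ K -ᶻ ((1ℤ +ᶻ L) +ᶻ (1ℤ +ᶻ L))
    regroup = solve-∀
  ... | even (suc l) | inj₂ (inj₁ (t≤d , d<2t)) = inj₁ (modᶻ-reflexive (begin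
    Δ P (suc l + suc l)
      ≡⟨ Δ-even (suc l) (s≤s d<2t) ⟩
    + (k ∸ l ∸ 𝟙 (t <? suc (suc l + suc l))) -ᶻ + (suc l + 𝟙 (0 <? suc l))
      ≡⟨ cong₂ (λ a b → + (k ∸ l ∸ a) -ᶻ + (suc l + b)) (𝟙-yes (t <? suc (suc l + suc l)) (s≤s t≤d)) (𝟙-yes (0 <? suc l) (s≤s z≤n)) ⟩
    + (k ∸ l ∸ 1) -ᶻ + (suc l + 1)
      ≡⟨ cong (_-ᶻ + (suc l + 1)) (trans (pos-∸ 1≤k∸l) (cong (_-ᶻ 1ℤ) (pos-∸ l≤k))) ⟩
    ((+ k -ᶻ + l) -ᶻ 1ℤ) -ᶻ + (suc l + 1)
      ≡⟨ regroup (+ t) (+ l) ⟩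
    + (t + t) -ᶻ + (suc l + suc l)
      ≡⟨ pos-∸ (ℕₚ.<⇒≤ d<2t) ⟨
    + (t + t ∸ (suc l + suc l))
      ≡⟨ cong +_ (mag-mid t≤d d<2t) ⟨
    + mag (suc l + suc l) ∎))
    where
    open ≡-Reasoning
    l≤k = ℕₚ.≤-trans (ℕₚ.n≤1+n l) (ℕₚ.≤-trans (ℕₚ.m≤m+n (suc l) (suc l)) (ℕₚ.<⇒≤ d<k))
    1≤k∸l : 1 ≤ k ∸ l
    1≤k∸l = ℕₚ.m<n⇒0<n∸m (ℕₚ.<-≤-trans (s≤s (ℕₚ.m≤m+n l (suc l))) (ℕₚ.<⇒≤ d<k))
    regroup : ∀ T L → (((1ℤ +ᶻ (T +ᶻ T)) -ᶻ L) -ᶻ 1ℤ) -ᶻ ((1ℤ +ᶻ L) +ᶻ 1ℤ) ≡ (T +ᶻ T) -ᶻ ((1ℤ +ᶻ L) +ᶻ (1ℤ +ᶻ L))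
    regroup = solve-∀
  ... | even (suc l) | inj₂ (inj₂ 2t≤d) =
    subst (λ x → Δ P (x + x) ≡ + mag (x + x) [modᶻ + (2 * k + 1) ] ⊎ Δ P (x + x) ≡ -ᶻ + mag (x + x) [modᶻ + (2 * k + 1) ])
          {t} {suc l} (sym (double-injective (2t≤d⇒d≡2t d<k 2t≤d))) (inj₂ (modᶻ-reflexive Δ-top))
  ... | odd l | inj₁ d<t = inj₂ (modᶻ-reflexive (begin
    Δ P (suc (l + l))
      ≡⟨ Δ-odd l (ℕₚ.<-≤-trans (s≤s d<t) (s≤s (ℕₚ.m≤m+n t t))) ⟩
    + (suc l + 𝟙 (0 <? suc l)) -ᶻ + (suc k ∸ l ∸ 𝟙 (t <? suc (l + l)))
      ≡⟨ cong₂ (λ b a → + (suc l + b) -ᶻ + (suc k ∸ l ∸ a)) (𝟙-yes (0 <? suc l) (s≤s z≤n)) (𝟙-no (t <? suc (l + l)) (ℕₚ.<⇒≯ d<t)) ⟩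
    + (suc l + 1) -ᶻ + (suc k ∸ l)
      ≡⟨ cong (λ z → + (suc l + 1) -ᶻ z) (pos-∸ l≤k+1) ⟩
    + (suc l + 1) -ᶻ (+ suc k -ᶻ + l)
      ≡⟨ regroup (+ k) (+ l) ⟩
    -ᶻ (+ k -ᶻ + suc (l + l))
      ≡⟨ cong -ᶻ_ (pos-∸ (ℕₚ.<⇒≤ d<k)) ⟨
    -ᶻ + (k ∸ suc (l + l))
      ≡⟨ cong (λ x → -ᶻ + x) (mag-low d<t) ⟨
    -ᶻ + mag (suc (l + l)) ∎))
    where
    open ≡-Reasoning
    l≤k+1 = ℕₚ.≤-trans (ℕₚ.m≤m+n l l) (ℕₚ.≤-trans (ℕₚ.n≤1+n _) (ℕₚ.≤-trans (ℕₚ.<⇒≤ d<k) (ℕₚ.n≤1+n k)))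
    regroup : ∀ K L → ((1ℤ +ᶻ L) +ᶻ 1ℤ) -ᶻ ((1ℤ +ᶻ K) -ᶻ L) ≡ -ᶻ (K -ᶻ (1ℤ +ᶻ (L +ᶻ L)))
    regroup = solve-∀
  ... | odd l | inj₂ (inj₁ (t≤d , d<2t)) = inj₂ (modᶻ-reflexive (begin
    Δ P (suc (l + l))
      ≡⟨ Δ-odd l (s≤s d<2t) ⟩
    + (suc l + 𝟙 (0 <? suc l)) -ᶻ + (suc k ∸ l ∸ 𝟙 (t <? suc (l + l)))
      ≡⟨ cong₂ (λ b a → + (suc l + b) -ᶻ + (suc k ∸ l ∸ a)) (𝟙-yes (0 <? suc l) (s≤s z≤n)) (𝟙-yes (t <? suc (l + l)) t<d) ⟩
    + (suc l + 1) -ᶻ + (suc k ∸ l ∸ 1)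
      ≡⟨ cong (λ z → + (suc l + 1) -ᶻ z) (trans (pos-∸ 1≤k+1∸l) (cong (_-ᶻ 1ℤ) (pos-∸ l≤k+1))) ⟩
    + (suc l + 1) -ᶻ ((+ suc k -ᶻ + l) -ᶻ 1ℤ)
      ≡⟨ regroup (+ t) (+ l) ⟩
    -ᶻ (+ (t + t) -ᶻ + suc (l + l))
      ≡⟨ cong -ᶻ_ (pos-∸ (ℕₚ.<⇒≤ d<2t)) ⟨
    -ᶻ + (t + t ∸ suc (l + l))
      ≡⟨ cong (λ x → -ᶻ + x) (mag-mid t≤d d<2t) ⟨
    -ᶻ + mag (suc (l + l)) ∎))
    where
    open ≡-Reasoning
    l≤k+1 = ℕₚ.≤-trans (ℕₚ.m≤m+n l l) (ℕₚ.≤-trans (ℕₚ.n≤1+n _) (ℕₚ.≤-trans (ℕₚ.<⇒≤ d<k) (ℕₚ.n≤1+n k)))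
    1≤k+1∸l : 1 ≤ suc k ∸ l
    1≤k+1∸l = ℕₚ.m<n⇒0<n∸m (s≤s l≤k+1′)
      where l≤k+1′ = ℕₚ.≤-trans (ℕₚ.m≤m+n l l) (ℕₚ.≤-trans (ℕₚ.n≤1+n _) (ℕₚ.<⇒≤ d<k))
    t<d : t < suc (l + l)
    t<d with ℕₚ.m≤n⇒m<n∨m≡n t≤d
    ... | inj₁ t<d = t<d
    ... | inj₂ t≡d = contradiction t≡d (double≢suc-double (suc m) l)
    regroup : ∀ T L → ((1ℤ +ᶻ L) +ᶻ 1ℤ) -ᶻ (((1ℤ +ᶻ (1ℤ +ᶻ (T +ᶻ T))) -ᶻ L) -ᶻ 1ℤ) ≡ -ᶻ ((T +ᶻ T) -ᶻ (1ℤ +ᶻ (L +ᶻ L)))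
    regroup = solve-∀
  ... | odd l | inj₂ (inj₂ 2t≤d) = contradiction (sym (2t≤d⇒d≡2t d<k 2t≤d)) (double≢suc-double t l)

  cycle : DifferenceCycle k
  cycle = FromMagnitudes.cycle k P mag mag⁻¹ P-closed P<M P-injective mag-pos mag≤k mag⁻¹-mag mag-mag⁻¹ mag⁻¹<k Δ≡±mag

differenceCycle : ∀ t → 1 ≤ t → DifferenceCycle (suc (t + t))
differenceCycle t 1≤t with evenOdd t
... | even zero    = contradiction 1≤t λ ()
... | even (suc m) = EvenHalf.cycle m
... | odd  m       = OddHalf.cycle m

-- The band array

module BandArray (q t : ℕ) (1≤t : 1 ≤ t) (t≤q : t ≤ q) (cycle : DifferenceCycle (suc (t + t))) where
  open DifferenceCycle cycle

  n k M w : ℕ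
  n = suc (q + q)
  k = suc (t + t)
  M = 2 * k + 1
  w = 2 * n * k + n

  k≤n : k ≤ n
  k≤n = s≤s (ℕₚ.+-mono-≤ t≤q t≤q)

  w≡n*M : + w ≡ + n *ᶻ + M
  w≡n*M = trans (cong +_ (factor n k)) (ℤₚ.pos-* n M)
    where
    factor : ∀ n k → 2 * n * k + n ≡ n * (2 * k + 1)
    factor = ℕ-Solver.solve-∀

  M∣w : + M ∣ᶻ + w
  M∣w = divides (+ n) w≡n*M

  *M-modᶻ : ∀ {a b} → a ≡ b [modᶻ + n ] → a *ᶻ + M ≡ b *ᶻ + M [modᶻ + w ]
  *M-modᶻ {a} {b} a≡b = subst (a *ᶻ + M ≡ b *ᶻ + M [modᶻ_]) (sym w≡n*M) (modᶻ-*ʳ-modulus (+ M) a≡b)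

  *M-modᶻ⁻¹ : ∀ {a b} → a *ᶻ + M ≡ b *ᶻ + M [modᶻ + w ] → a ≡ b [modᶻ + n ]
  *M-modᶻ⁻¹ {a} {b} aM≡bM = modᶻ-*ʳ-modulus⁻¹ (+ M) (subst (a *ᶻ + M ≡ b *ᶻ + M [modᶻ_]) w≡n*M aM≡bM)

  -- u = Δ κ takes the values 1 and ±2, units modulo the odd n. The rows are read with the potential
  -- κ and the columns with d ↦ κ d · d - ε d, where ε is a discrete antiderivative of κ.
  ε : ℕ → ℤ
  ε d with d <? k
  ... | yes _ = + (d % 2)
  ... | no  _ = 0ℤ

  κ : ℕ → ℤ
  κ zero    = 0ℤ
  κ (suc d) = ε (suc d) -ᶻ ε d

  u : ℕ → ℤ
  u d = κ (suc d) -ᶻ κ d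

  ε-even : ∀ l → ε (l + l) ≡ 0ℤ
  ε-even l with l + l <? k
  ... | yes _ = cong +_ (trans (cong (_% 2) (l+l≡l*2 l)) (m*n%n≡0 l 2))
    where
    l+l≡l*2 : ∀ l → l + l ≡ l * 2
    l+l≡l*2 = ℕ-Solver.solve-∀
  ... | no  _ = refl

  ε-odd : ∀ l → suc (l + l) < k → ε (suc (l + l)) ≡ 1ℤ
  ε-odd l l<k with suc (l + l) <? k
  ... | yes _   = cong +_ (trans (cong (_% 2) (1+l+l≡1+l*2 l)) ([m+kn]%n≡m%n 1 l 2))
    where
    1+l+l≡1+l*2 : ∀ l → suc (l + l) ≡ 1 + l * 2
    1+l+l≡1+l*2 = ℕ-Solver.solve-∀
  ... | no  l≮k = contradiction l<k l≮k

  ε-k : ε k ≡ 0ℤ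
  ε-k with k <? k
  ... | yes k<k = contradiction k<k (ℕₚ.<-irrefl refl)
  ... | no  _   = refl

  κ-k : κ k ≡ 0ℤ
  κ-k = cong₂ _-ᶻ_ ε-k (ε-even t)

  1<k : 1 < k
  1<k = s≤s (ℕₚ.≤-trans 1≤t (ℕₚ.m≤m+n t t))

  u-suc : ∀ e {a b c} → ε (suc (suc e)) ≡ a → ε (suc e) ≡ b → ε e ≡ c → u (suc e) ≡ (a -ᶻ b) -ᶻ (b -ᶻ c)
  u-suc e refl refl refl = refl

  ε-before-even : ∀ {l} → suc l + suc l < k → ε (l + suc l) ≡ 1ℤ
  ε-before-even {l} d<k = trans (cong ε (ℕₚ.+-suc l l))
    (ε-odd l (ℕₚ.<-trans (subst (suc (l + l) <_) (cong suc (sym (ℕₚ.+-suc l l))) (ℕₚ.n<1+n _)) d<k))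

  u-values : ∀ {d} → d < k → u d ≡ 1ℤ ⊎ u d ≡ + 2 ⊎ u d ≡ -ᶻ + 2
  u-values {d} d<k with evenOdd d
  ... | even zero = inj₁ (cong (_-ᶻ 0ℤ) (cong₂ _-ᶻ_ (ε-odd 0 1<k) (ε-even 0)))
  ... | odd l = inj₂ (inj₂ (u-suc (l + l) (trans (cong ε (cong suc (sym (ℕₚ.+-suc l l)))) (ε-even (suc l)))
                                          (ε-odd l d<k) (ε-even l)))
  ... | even (suc l) with ℕₚ.m≤n⇒m<n∨m≡n d<k
  ...   | inj₁ d+1<k = inj₂ (inj₁ (u-suc (l + suc l) (ε-odd (suc l) d+1<k) (ε-even (suc l)) (ε-before-even d<k)))
  ...   | inj₂ d+1≡k = inj₁ (u-suc (l + suc l) (trans (cong ε d+1≡k) ε-k) (ε-even (suc l)) (ε-before-even d<k))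

  u-invertible : ∀ {d} → d < k → ∃ λ v → v *ᶻ u d ≡ 1ℤ [modᶻ + n ]
  u-invertible d<k with u-values d<k
  ... | inj₁ u≡1         = 1ℤ , modᶻ-reflexive (cong (1ℤ *ᶻ_) u≡1)
  ... | inj₂ (inj₁ u≡2)  = + suc q , modᶻ (divides 1ℤ (trans (cong (λ x → + suc q *ᶻ x -ᶻ 1ℤ) u≡2) (half-of-n+1 (+ q))))
    where
    half-of-n+1 : ∀ Q → (1ℤ +ᶻ Q) *ᶻ + 2 -ᶻ 1ℤ ≡ 1ℤ *ᶻ (1ℤ +ᶻ (Q +ᶻ Q))
    half-of-n+1 = solve-∀
  ... | inj₂ (inj₂ u≡-2) = -ᶻ + suc q , modᶻ (divides 1ℤ (trans (cong (λ x → -ᶻ + suc q *ᶻ x -ᶻ 1ℤ) u≡-2) (half-of-n+1 (+ q))))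
    where
    half-of-n+1 : ∀ Q → -ᶻ (1ℤ +ᶻ Q) *ᶻ -ᶻ + 2 -ᶻ 1ℤ ≡ 1ℤ *ᶻ (1ℤ +ᶻ (Q +ᶻ Q))
    half-of-n+1 = solve-∀

  u-cancel : ∀ {d a b} → d < k → u d *ᶻ a ≡ u d *ᶻ b [modᶻ + n ] → a ≡ b [modᶻ + n ]
  u-cancel {d} {a} {b} d<k ua≡ub = begin
    a                    ≡⟨ ℤₚ.*-identityˡ a ⟨
    1ℤ *ᶻ a              ≈⟨ modᶻ-*ʳ a v*u≡1 ⟨
    v *ᶻ u d *ᶻ a        ≡⟨ ℤₚ.*-assoc v (u d) a ⟩
    v *ᶻ (u d *ᶻ a)      ≈⟨ modᶻ-*ˡ v ua≡ub ⟩
    v *ᶻ (u d *ᶻ b)      ≡⟨ ℤₚ.*-assoc v (u d) b ⟨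
    v *ᶻ u d *ᶻ b        ≈⟨ modᶻ-*ʳ b v*u≡1 ⟩
    1ℤ *ᶻ b              ≡⟨ ℤₚ.*-identityˡ b ⟩
    b                    ∎
    where
    open ≡-modᶻ-Reasoning (+ n)
    v = proj₁ (u-invertible d<k)
    v*u≡1 = proj₂ (u-invertible d<k)

  rowPotential colPotential : ℕ → ℕ → ℤ
  rowPotential i d = + P d +ᶻ (+ i *ᶻ κ d) *ᶻ + M
  colPotential j d = + P d +ᶻ (κ d *ᶻ (+ d -ᶻ + j) -ᶻ ε d) *ᶻ + M

  rowStep colStep : ℕ → ℕ → ℤ
  rowStep i d = rowPotential i (suc d) -ᶻ rowPotential i d
  colStep j d = colPotential j (suc d) -ᶻ colPotential j d

  rowStep≡ : ∀ i d → rowStep i d ≡ Δ P d +ᶻ (u d *ᶻ + i) *ᶻ + M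
  rowStep≡ i d = regroup (+ P (suc d)) (+ P d) (+ i) (κ (suc d)) (κ d) (+ M)
    where
    regroup : ∀ p₁ p₀ i κ₁ κ₀ m →
      (p₁ +ᶻ (i *ᶻ κ₁) *ᶻ m) -ᶻ (p₀ +ᶻ (i *ᶻ κ₀) *ᶻ m) ≡ (p₁ -ᶻ p₀) +ᶻ ((κ₁ -ᶻ κ₀) *ᶻ i) *ᶻ m
    regroup = solve-∀

  colStep≡ : ∀ j d → colStep j d ≡ Δ P d +ᶻ (u d *ᶻ (+ d -ᶻ + j)) *ᶻ + M
  colStep≡ j d = regroup (+ P (suc d)) (+ P d) (ε (suc d)) (ε d) (κ d) (+ d) (+ j) (+ M)
    where
    regroup : ∀ p₁ p₀ e₁ e₀ κ₀ d j m →
      (p₁ +ᶻ ((e₁ -ᶻ e₀) *ᶻ ((1ℤ +ᶻ d) -ᶻ j) -ᶻ e₁) *ᶻ m) -ᶻ (p₀ +ᶻ (κ₀ *ᶻ (d -ᶻ j) -ᶻ e₀) *ᶻ m)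
      ≡ (p₁ -ᶻ p₀) +ᶻ (((e₁ -ᶻ e₀) -ᶻ κ₀) *ᶻ (d -ᶻ j)) *ᶻ m
    regroup = solve-∀

  rowPotential-closed : ∀ i → rowPotential i k ≡ rowPotential i 0
  rowPotential-closed i = cong₂ (λ p c → + p +ᶻ (+ i *ᶻ c) *ᶻ + M) closed κ-k

  colPotential-closed : ∀ j → colPotential j k ≡ colPotential j 0
  colPotential-closed j = begin
    + P k +ᶻ (κ k *ᶻ (+ k -ᶻ + j) -ᶻ ε k) *ᶻ + M    ≡⟨ cong₂ (λ c e → + P k +ᶻ (c *ᶻ (+ k -ᶻ + j) -ᶻ e) *ᶻ + M) κ-k ε-k ⟩
    + P k +ᶻ (0ℤ -ᶻ 0ℤ) *ᶻ + M                    ≡⟨ cong₂ (λ p e → + p +ᶻ (0ℤ -ᶻ e) *ᶻ + M) closed (sym (ε-even 0)) ⟩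
    + P 0 +ᶻ (κ 0 *ᶻ (+ 0 -ᶻ + j) -ᶻ ε 0) *ᶻ + M  ∎
    where open ≡-Reasoning

  rowStep≡colStep : ∀ {i j d} → d < k → + d ≡ + i +ᶻ + j [modᶻ + n ] → rowStep i d ≡ colStep j d [modᶻ + w ]
  rowStep≡colStep {i} {j} {d} d<k d≡i+j = begin
    rowStep i d                                ≡⟨ rowStep≡ i d ⟩
    Δ P d +ᶻ (u d *ᶻ + i) *ᶻ + M               ≈⟨ modᶻ-+ (modᶻ-refl {a = Δ P d}) (*M-modᶻ (modᶻ-*ˡ (u d) i≡d-j)) ⟩
    Δ P d +ᶻ (u d *ᶻ (+ d -ᶻ + j)) *ᶻ + M      ≡⟨ colStep≡ j d ⟨
    colStep j d                                ∎
    where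
    open ≡-modᶻ-Reasoning (+ w)
    i≡d-j : + i ≡ + d -ᶻ + j [modᶻ + n ]
    i≡d-j = modᶻ-sym (subst (+ d -ᶻ + j ≡_[modᶻ + n ]) (cancel (+ i) (+ j))
                            (modᶻ-+ d≡i+j (modᶻ-refl {a = -ᶻ + j})))
      where
      cancel : ∀ i j → (i +ᶻ j) -ᶻ j ≡ i
      cancel = solve-∀

  toF : ℤ → Fin w
  toF x = Fin.fromℕ< (ℤ%.n%ℕd<d x w)

  toF-modᶻ : ∀ x → + toℕ (toF x) ≡ x [modᶻ + w ]
  toF-modᶻ x = subst (_≡ x [modᶻ + w ]) (cong +_ (sym (Finₚ.toℕ-fromℕ< _))) (%ℕ-modᶻ x w)

  toF-cong : ∀ {x y} → x ≡ y [modᶻ + w ] → toF x ≡ toF y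
  toF-cong {x} {y} x≡y = Finₚ.toℕ-injective (modᶻ⇒≡ (Finₚ.toℕ<n _) (Finₚ.toℕ<n _)
    (modᶻ-trans (toF-modᶻ x) (modᶻ-trans x≡y (modᶻ-sym (toF-modᶻ y)))))

  toF-injective : ∀ {x y} → toF x ≡ toF y → x ≡ y [modᶻ + w ]
  toF-injective {x} {y} eq =
    modᶻ-trans (modᶻ-sym (toF-modᶻ x)) (modᶻ-trans (modᶻ-reflexive (cong (λ f → + toℕ f) eq)) (toF-modᶻ y))

  toF-toℕ : ∀ (x : Fin w) → toF (+ toℕ x) ≡ x
  toF-toℕ x = Finₚ.toℕ-injective (modᶻ⇒≡ (Finₚ.toℕ<n _) (Finₚ.toℕ<n x) (toF-modᶻ (+ toℕ x)))

  lineCell : (ℕ → ℤ) → ℕ → Maybe (Fin w)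
  lineCell f d with d <? k
  ... | yes _ = just (toF (f d))
  ... | no  _ = nothing

  lineCell-filled : ∀ f {d} → d < k → lineCell f d ≡ just (toF (f d))
  lineCell-filled f {d} d<k with d <? k
  ... | yes _   = refl
  ... | no  d≮k = contradiction d<k d≮k

  lineCell-empty : ∀ f {d} → k ≤ d → lineCell f d ≡ nothing
  lineCell-empty f {d} k≤d with d <? k
  ... | yes d<k = contradiction k≤d (ℕₚ.<⇒≱ d<k)
  ... | no  _   = refl

  lineCell-inv : ∀ f {d y} → lineCell f d ≡ just y → d < k × toF (f d) ≡ y
  lineCell-inv f {d} eq with d <? k | eq
  ... | yes d<k | eq′ = d<k , just-injective eq′
  ... | no  _   | ()

  lineCell-cong : ∀ {f g} d → (d < k → f d ≡ g d [modᶻ + w ]) → lineCell f d ≡ lineCell g d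
  lineCell-cong d f≡g with d <? k
  ... | yes d<k = cong just (toF-cong (f≡g d<k))
  ... | no  _   = refl

  A : Array n w
  A i j = lineCell (rowStep (toℕ i)) ((toℕ i + toℕ j) % n)

  row-rotation : ∀ i → ∃ λ ρ → rowEntries A i ≡ map (toF ∘ rowStep (toℕ i)) (rotation k ρ)
  row-rotation i = map₂ (trans (mapMaybe-allFin n (λ x → lineCell (rowStep (toℕ i)) ((toℕ i + x) % n))))
    (band-line (lineCell (rowStep (toℕ i))) (toF ∘ rowStep (toℕ i)) k≤n (Finₚ.toℕ<n i)
               (lineCell-filled (rowStep (toℕ i))) (lineCell-empty (rowStep (toℕ i))))

  col-rotation : ∀ j → ∃ λ ρ → colEntries A j ≡ map (toF ∘ colStep (toℕ j)) (rotation k ρ)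
  col-rotation j = map₂ (trans (mapMaybe-allFin n (λ x → lineCell (rowStep x) ((x + toℕ j) % n)))
                        ∘ trans (cong catMaybes (applyUpTo-cong n realign)))
    (band-line (lineCell (colStep (toℕ j))) (toF ∘ colStep (toℕ j)) k≤n (Finₚ.toℕ<n j)
               (lineCell-filled (colStep (toℕ j))) (lineCell-empty (colStep (toℕ j))))
    where
    realign : ∀ {x} → x < n → lineCell (rowStep x) ((x + toℕ j) % n) ≡ lineCell (colStep (toℕ j)) ((toℕ j + x) % n)
    realign {x} _ = trans (cong (λ d → lineCell (rowStep x) (d % n)) (ℕₚ.+-comm x (toℕ j)))
      (lineCell-cong ((toℕ j + x) % n) (λ d<k → rowStep≡colStep {x} {toℕ j} d<k (modᶻ-trans (%-modᶻ (toℕ j + x) n)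
        (modᶻ-reflexive (trans (ℤₚ.pos-+ (toℕ j) x) (ℤₚ.+-comm (+ toℕ j) (+ x)))))))

  potential-injective : ∀ (G : ℕ → ℤ) → (∀ a → G a ≡ + P a [modᶻ + M ]) →
                        ∀ {a b} → a < k → b < k → G a ≡ G b [modᶻ + M ] → a ≡ b
  potential-injective G G≡P a<k b<k Ga≡Gb = injective a<k b<k (modᶻ-trans (modᶻ-sym (G≡P _)) (modᶻ-trans Ga≡Gb (G≡P _)))

  module RowLine (i : ℕ) = Line M∣w (rowPotential i) (rowPotential-closed i)
    (potential-injective (rowPotential i) (λ a → +-multiple-modᶻ (+ P a) (+ i *ᶻ κ a)))
    (toF ∘ rowStep i) (λ {d} _ → toF-modᶻ (rowStep i d))

  module ColLine (j : ℕ) = Line M∣w (colPotential j) (colPotential-closed j)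
    (potential-injective (colPotential j) (λ a → +-multiple-modᶻ (+ P a) (κ a *ᶻ (+ a -ᶻ + j) -ᶻ ε a)))
    (toF ∘ colStep j) (λ {d} _ → toF-modᶻ (colStep j d))

  row-property : (Q : List (Fin w) → Set) → (∀ i ρ → Q (map (toF ∘ rowStep i) (rotation k ρ))) → ∀ i → Q (rowEntries A i)
  row-property Q holds i = subst Q (sym (proj₂ (row-rotation i))) (holds (toℕ i) (proj₁ (row-rotation i)))

  col-property : (Q : List (Fin w) → Set) → (∀ j ρ → Q (map (toF ∘ colStep j) (rotation k ρ))) → ∀ j → Q (colEntries A j)
  col-property Q holds j = subst Q (sym (proj₂ (col-rotation j))) (holds (toℕ j) (proj₁ (col-rotation j)))

  entry-residue : ∀ i d → + toℕ (toF (rowStep i d)) ≡ Δ P d [modᶻ + M ]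
  entry-residue i d = modᶻ-trans (modᶻ-divisor M∣w (toF-modᶻ (rowStep i d)))
    (modᶻ-trans (modᶻ-reflexive (rowStep≡ i d)) (+-multiple-modᶻ (Δ P d) (u d *ᶻ + i)))

  diagonal : Fin n → Fin n → ℕ
  diagonal i j = (toℕ i + toℕ j) % n

  cell-inv : ∀ i j {y} → A i j ≡ just y → diagonal i j < k × toF (rowStep (toℕ i) (diagonal i j)) ≡ y
  cell-inv i j = lineCell-inv (rowStep (toℕ i))

  entriesDistinct : ∀ i j i′ j′ x → A i j ≡ just x → A i′ j′ ≡ just x → (i ≡ i′) × (j ≡ j′)
  entriesDistinct i j i′ j′ x Aij≡x Ai′j′≡x = i≡i′ , j≡j′
    where
    d = diagonal i j
    d′ = diagonal i′ j′
    d<k = proj₁ (cell-inv i j Aij≡x)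
    same : rowStep (toℕ i) d ≡ rowStep (toℕ i′) d′ [modᶻ + w ]
    same = toF-injective (trans (proj₂ (cell-inv i j Aij≡x)) (sym (proj₂ (cell-inv i′ j′ Ai′j′≡x))))
    d≡d′ : d ≡ d′
    d≡d′ = Δ-injective d<k (proj₁ (cell-inv i′ j′ Ai′j′≡x)) (begin
      Δ P d                               ≈⟨ entry-residue (toℕ i) d ⟨
      + toℕ (toF (rowStep (toℕ i) d))     ≈⟨ modᶻ-divisor M∣w (modᶻ-reflexive (cong (λ y → + toℕ y) (toF-cong same))) ⟩
      + toℕ (toF (rowStep (toℕ i′) d′))   ≈⟨ entry-residue (toℕ i′) d′ ⟩
      Δ P d′                              ∎)
      where open ≡-modᶻ-Reasoning (+ M)
    i≡i′ : i ≡ i′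
    i≡i′ = Finₚ.toℕ-injective (modᶻ⇒≡ (Finₚ.toℕ<n i) (Finₚ.toℕ<n i′) (u-cancel d<k
      (*M-modᶻ⁻¹ (modᶻ-+-cancelˡ (Δ P d) (subst₂ (_≡_[modᶻ + w ]) (rowStep≡ (toℕ i) d)
        (trans (cong (rowStep (toℕ i′)) (sym d≡d′)) (rowStep≡ (toℕ i′) d)) same)))))
    j≡j′ : j ≡ j′
    j≡j′ = Finₚ.toℕ-injective (%-injective (toℕ i) (Finₚ.toℕ<n j) (Finₚ.toℕ<n j′)
      (trans d≡d′ (cong (λ a → (a + toℕ j′) % n) (cong toℕ (sym i≡i′)))))

  cell-residue : ∀ i j {y} → A i j ≡ just y → ∃ λ d → d < k × + toℕ y ≡ Δ P d [modᶻ + M ]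
  cell-residue i j Aij≡y = diagonal i j , proj₁ inv ,
    subst (λ y → + toℕ y ≡ Δ P (diagonal i j) [modᶻ + M ]) (proj₂ inv) (entry-residue (toℕ i) (diagonal i j))
    where inv = cell-inv i j Aij≡y

  u*-surjective : ∀ {d} → d < k → ∀ y → ∃ λ i → i < n × u d *ᶻ + i ≡ y [modᶻ + n ]
  u*-surjective {d} d<k y = i , ℤ%.n%ℕd<d (v *ᶻ y) n , (begin
    u d *ᶻ + i            ≈⟨ modᶻ-*ˡ (u d) (%ℕ-modᶻ (v *ᶻ y) n) ⟩
    u d *ᶻ (v *ᶻ y)       ≡⟨ ℤₚ.*-assoc (u d) v y ⟨
    u d *ᶻ v *ᶻ y         ≈⟨ modᶻ-*ʳ y (subst (_≡ 1ℤ [modᶻ + n ]) (ℤₚ.*-comm v (u d)) (proj₂ (u-invertible d<k))) ⟩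
    1ℤ *ᶻ y               ≡⟨ ℤₚ.*-identityˡ y ⟩
    y                     ∎)
    where
    open ≡-modᶻ-Reasoning (+ n)
    v = proj₁ (u-invertible d<k)
    i = (v *ᶻ y) ℤ.%ℕ n

  rowStep-surjective : ∀ {d} → d < k → ∀ y → Δ P d ≡ y [modᶻ + M ] → ∃ λ i → i < n × rowStep i d ≡ y [modᶻ + w ]
  rowStep-surjective {d} d<k y (modᶻ (divides Q Δ-y≡Q*M)) = i , i<n , (begin
    rowStep i d                     ≡⟨ rowStep≡ i d ⟩
    Δ P d +ᶻ (u d *ᶻ + i) *ᶻ + M    ≈⟨ modᶻ-+ (modᶻ-refl {a = Δ P d}) (*M-modᶻ ui≡-Q) ⟩
    Δ P d +ᶻ (-ᶻ Q) *ᶻ + M          ≡⟨ cong (Δ P d +ᶻ_) (ℤₚ.neg-distribˡ-* Q (+ M)) ⟨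
    Δ P d -ᶻ Q *ᶻ + M               ≡⟨ cong (λ z → Δ P d -ᶻ z) Δ-y≡Q*M ⟨
    Δ P d -ᶻ (Δ P d -ᶻ y)           ≡⟨ cancel (Δ P d) y ⟩
    y                               ∎)
    where
    open ≡-modᶻ-Reasoning (+ w)
    cancel : ∀ a b → a -ᶻ (a -ᶻ b) ≡ b
    cancel = solve-∀
    i = proj₁ (u*-surjective d<k (-ᶻ Q))
    i<n = proj₁ (proj₂ (u*-surjective d<k (-ᶻ Q)))
    ui≡-Q = proj₂ (proj₂ (u*-surjective d<k (-ᶻ Q)))

  on-diagonal : ∀ {i d} → i < n → d < n → ∃ λ j → j < n × (i + j) % n ≡ d
  on-diagonal {i} {d} i<n d<n = j , m%n<n (n ∸ i + d) n , modᶻ⇒≡ (m%n<n (i + j) n) d<n (begin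
    + ((i + j) % n)               ≈⟨ %-modᶻ (i + j) n ⟩
    + (i + j)                     ≡⟨ ℤₚ.pos-+ i j ⟩
    + i +ᶻ + j                    ≈⟨ modᶻ-+ (modᶻ-refl {a = + i}) (%-modᶻ (n ∸ i + d) n) ⟩
    + i +ᶻ + (n ∸ i + d)          ≡⟨ ℤₚ.pos-+ i (n ∸ i + d) ⟨
    + (i + (n ∸ i + d))           ≡⟨ cong +_ (trans (sym (ℕₚ.+-assoc i (n ∸ i) d)) (cong (_+ d) (ℕₚ.m+[n∸m]≡n (ℕₚ.<⇒≤ i<n)))) ⟩
    + (n + d)                     ≡⟨ trans (ℤₚ.pos-+ n d) (trans (ℤₚ.+-comm (+ n) (+ d)) (cong (+ d +ᶻ_) (sym (ℤₚ.*-identityˡ (+ n))))) ⟩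
    + d +ᶻ 1ℤ *ᶻ + n              ≈⟨ +-multiple-modᶻ (+ d) 1ℤ ⟩
    + d                           ∎)
    where
    open ≡-modᶻ-Reasoning (+ n)
    j = (n ∸ i + d) % n

  cell-with-residue : ∀ {d} → d < k → ∀ y → Δ P d ≡ y [modᶻ + M ] → ∃ λ i → ∃ λ j → A i j ≡ just (toF y)
  cell-with-residue {d} d<k y Δ≡y = Fin.fromℕ< i<n , Fin.fromℕ< j<n , (begin
    lineCell (rowStep (toℕ (Fin.fromℕ< i<n))) ((toℕ (Fin.fromℕ< i<n) + toℕ (Fin.fromℕ< j<n)) % n)
      ≡⟨ cong₂ (λ a b → lineCell (rowStep a) ((a + b) % n)) (Finₚ.toℕ-fromℕ< i<n) (Finₚ.toℕ-fromℕ< j<n) ⟩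
    lineCell (rowStep i) ((i + j) % n)   ≡⟨ cong (lineCell (rowStep i)) i+j≡d ⟩
    lineCell (rowStep i) d               ≡⟨ lineCell-filled (rowStep i) d<k ⟩
    just (toF (rowStep i d))             ≡⟨ cong just (toF-cong row≡y) ⟩
    just (toF y)                         ∎)
    where
    open ≡-Reasoning
    i = proj₁ (rowStep-surjective d<k y Δ≡y)
    i<n = proj₁ (proj₂ (rowStep-surjective d<k y Δ≡y))
    row≡y = proj₂ (proj₂ (rowStep-surjective d<k y Δ≡y))
    j = proj₁ (on-diagonal i<n (ℕₚ.<-≤-trans d<k k≤n))
    j<n = proj₁ (proj₂ (on-diagonal i<n (ℕₚ.<-≤-trans d<k k≤n)))
    i+j≡d = proj₂ (proj₂ (on-diagonal i<n (ℕₚ.<-≤-trans d<k k≤n)))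

  member-residue : ∀ {Q : Fin w → Set} → Any Q (allEntries A) →
                   ∃ λ y → Q y × ∃ λ d → d < k × + toℕ y ≡ Δ P d [modᶻ + M ]
  member-residue p =
    let i , j , cell      = Any-allEntries⁻ A p
        y , Aij≡y , q     = MaybeAny⇒ cell
    in y , q , cell-residue i j Aij≡y

  halfSet : ∀ x → (¬ J-order-n n k x) ⇔
            (x ∈ allEntries A ⊎ Any (λ y → (toℕ y + toℕ x) ≡ 0 [mod w ]) (allEntries A))
  halfSet x = mk⇔ (λ x∉J → covered (Δ-covers (toℕ x) (x∉J ∘ modᶻ0⇒∣))) avoids-J
    where
    Opposite : Fin w → Set
    Opposite y = (toℕ y + toℕ x) ≡ 0 [mod w ]

    covered : (∃ λ d → d < k × (Δ P d ≡ + toℕ x [modᶻ + M ] ⊎ Δ P d ≡ -ᶻ + toℕ x [modᶻ + M ])) →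
              x ∈ allEntries A ⊎ Any Opposite (allEntries A)
    covered (d , d<k , inj₁ Δ≡x) =
      let i , j , Aij≡ = cell-with-residue d<k (+ toℕ x) Δ≡x
      in inj₁ (Any-allEntries⁺ A i j (subst (MaybeAny (x ≡_)) (sym Aij≡) (just (sym (toF-toℕ x)))))
    covered (d , d<k , inj₂ Δ≡-x) =
      let i , j , Aij≡ = cell-with-residue d<k (-ᶻ + toℕ x) Δ≡-x
      in inj₂ (Any-allEntries⁺ A i j (subst (MaybeAny Opposite) (sym Aij≡) (just (modᶻ⇒[mod] (begin
        + (toℕ (toF (-ᶻ + toℕ x)) + toℕ x)       ≡⟨ ℤₚ.pos-+ (toℕ (toF (-ᶻ + toℕ x))) (toℕ x) ⟩
        + toℕ (toF (-ᶻ + toℕ x)) +ᶻ + toℕ x      ≈⟨ modᶻ-+ (toF-modᶻ (-ᶻ + toℕ x)) (modᶻ-refl {a = + toℕ x}) ⟩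
        -ᶻ + toℕ x +ᶻ + toℕ x                    ≡⟨ ℤₚ.+-inverseˡ (+ toℕ x) ⟩
        0ℤ                                       ∎)))))
      where open ≡-modᶻ-Reasoning (+ w)

    avoids-J : x ∈ allEntries A ⊎ Any Opposite (allEntries A) → ¬ J-order-n n k x
    avoids-J (inj₁ x∈A) M∣x =
      let y , x≡y , d , d<k , y≡Δ = member-residue x∈A
      in Δ-nonzero d<k (begin
        Δ P d         ≈⟨ y≡Δ ⟨
        + toℕ y       ≡⟨ cong (λ z → + toℕ z) x≡y ⟨
        + toℕ x       ≈⟨ ∣⇒modᶻ0 M∣x ⟩
        0ℤ            ∎)
      where open ≡-modᶻ-Reasoning (+ M)
    avoids-J (inj₂ -x∈A) M∣x =
      let y , y+x≡0 , d , d<k , y≡Δ = member-residue -x∈A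
      in Δ-nonzero d<k (begin
        Δ P d                     ≡⟨ ℤₚ.+-identityʳ (Δ P d) ⟨
        Δ P d +ᶻ 0ℤ               ≈⟨ modᶻ-+ (modᶻ-sym y≡Δ) (modᶻ-sym (∣⇒modᶻ0 M∣x)) ⟩
        + toℕ y +ᶻ + toℕ x        ≡⟨ ℤₚ.pos-+ (toℕ y) (toℕ x) ⟨
        + (toℕ y + toℕ x)         ≈⟨ modᶻ-divisor M∣w ([mod]⇒modᶻ y+x≡0) ⟩
        0ℤ                        ∎)
      where open ≡-modᶻ-Reasoning (+ M)

  heffter : IsHeffter n k n (J-order-n n k) A
  heffter = record
    { rowsFilled      = row-property (λ xs → length xs ≡ k) RowLine.length-line
    ; colsFilled      = col-property (λ xs → length xs ≡ k) ColLine.length-line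
    ; entriesDistinct = entriesDistinct
    ; halfSet         = halfSet
    ; rowSums         = row-property (SumsToZero w) RowLine.sum-line
    ; colSums         = col-property (SumsToZero w) ColLine.sum-line
    }

  globallySimple : GloballySimple A
  globallySimple = row-property (SimpleOrdering w) RowLine.simple-line , col-property (SimpleOrdering w) ColLine.simple-line

globallySimpleHeffter : ∀ q t → 1 ≤ t → t ≤ q →
  let n = suc (q + q) ; k = suc (t + t) in
  Σ (Array n (2 * n * k + n)) λ A → IsHeffter n k n (J-order-n n k) A × GloballySimple A
globallySimpleHeffter q t 1≤t t≤q = A , heffter , globallySimple
  where open BandArray q t 1≤t t≤q (differenceCycle t 1≤t)

2∣double : ∀ l → 2 ∣ l + l
2∣double l = ℕ∣.divides l (trans (cong (λ y → l + y) (sym (ℕₚ.+-identityʳ l))) (ℕₚ.*-comm 2 l))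

halve-3≤ : ∀ {t} → 3 ≤ suc (t + t) → 1 ≤ t
halve-3≤ {zero}  (s≤s ())
halve-3≤ {suc _} _ = s≤s z≤n

halve-≤ : ∀ {t q} → suc (t + t) ≤ suc (q + q) → t ≤ q
halve-≤ {t} {q} (s≤s 2t≤2q) = ℕₚ.≮⇒≥ (λ q<t → ℕₚ.<⇒≱ (ℕₚ.+-mono-< q<t q<t) 2t≤2q)

theorem4p1 : ∀ (n k : ℕ) → ¬ (2 ∣ n) → n ≥ 3 → k ≥ 3 → k ∣ n →
    Σ (Array n (2 * n * k + n)) λ A → IsHeffter n k n (J-order-n n k) A × GloballySimple A
theorem4p1 n k n-odd _ k≥3 k∣n with evenOdd n | evenOdd k
... | even q | _      = contradiction (2∣double q) n-odd
... | odd q  | even t = contradiction (ℕ∣.∣-trans (2∣double t) k∣n) n-odd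
... | odd q  | odd t  = globallySimpleHeffter q t (halve-3≤ k≥3) (halve-≤ (ℕ∣.∣⇒≤ k∣n))
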